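{- Let $\sigma\in\mathfrak{S}_n$. Then \[ \sum_{v\in G(\sigma)} d_{\mathcal{C}}(v)=\left(\sum_{i\in\mathrm{Des}(\sigma)}\ \sum_{u\in G(\sigma s_i)} d_{\mathcal{C}}(u)\right)+2\sum_{\substack{i,j\in\mathrm{Des}(\sigma)\\ i-j>1}}|\mathcal{R}(\sigma s_js_i)|, \] where on the right $d_{\mathcal{C}}(u)$ is the commutation degree of $u$ in $G(\sigma s_i)$, and on the left $d_{\mathcal{C}}(v)$ is the commutation degree of $v$ in $G(\sigma)$.
   Context: $\mathfrak{S}_n$ is the symmetric group on $[n]$ with simple transpositions $s_i=(i\ i+1)$; $\ell$ is the inversion number; $\mathcal{R}(\sigma)$ is the set of reduced words of $\sigma$ (words $i_1\cdots i_l$ with $l=\ell(\sigma)$ and $\sigma=s_{i_1}\cdots s_{i_l}$); $\mathrm{Des}(\sigma)=\{i:\sigma(i)>\sigma(i+1)\}$. $G(\sigma)$ is the graph on $\mathcal{R}(\sigma)$ with commutation edges joining words related by a single move $ab\to ba$ on adjacent letters with $|a-b|>1$, and braid edges joining words related by a single move $a(a+1)a\leftrightarrow(a+1)a(a+1)$ on adjacent letters. $d_{\mathcal{C}}(v)$ denotes the number of commutation edges incident to $v$. -}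

module Defs where

open import Data.Nat using (ℕ; zero; suc; _+_; _∸_; _<_; _≤_; ∣_-_∣)
import Data.Nat
import Data.Fin
import Data.Nat.Properties
open import Data.Nat.Properties using () renaming (_≟_ to _≟ℕ_)
open import Data.Fin using (Fin; toℕ; fromℕ<) renaming (_≟_ to _≟F_)
open import Data.Fin.Permutation using (Permutation′; _⟨$⟩ʳ_; _∘ₚ_; transpose) renaming (id to idₚ)
open import Data.List using (List; []; _∷_; map; concatMap; filter; length; allFin; upTo; _++_)
open import Data.Nat.ListAction using (sum)
open import Data.List.Properties using (≡-dec)
open import Data.List.Membership.DecPropositional (≡-dec _≟ℕ_) using (_∈?_)
open import Data.List.Relation.Unary.All using (All; all?)
open import Data.Product using (_×_; _,_)
open import Relation.Nullary using (Dec; yes; no)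
open import Relation.Nullary.Decidable using (_×-dec_)
open import Relation.Binary.PropositionalEquality using (_≡_)

-- Conventions: permutations of [n] are bijections Fin n ↔ Fin n, where
-- Fin n = {0,…,n-1} stands for [n] = {1,…,n} (k ↦ k+1).
-- Letters of words are natural numbers; the letter i denotes s_i = (i i+1),
-- which for 1 ≤ i ≤ n-1 is the transposition of the Fin-elements i-1 and i.

-- the simple transposition s_i in S_n (identity if i is not in 1..n-1;
-- such letters never occur in reduced words, see `words` below)
s : {n : ℕ} → ℕ → Permutation′ n
s {n} zero = idₚ
s {n} (suc k) with suc k Data.Nat.<? n
... | yes p = transpose (fromℕ< (Data.Nat.Properties.<-trans (Data.Nat.Properties.n<1+n k) p)) (fromℕ< p)
... | no _ = idₚ

-- composition as functions: (σ · τ)(x) = σ(τ(x))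
infixl 7 _·_
_·_ : {n : ℕ} → Permutation′ n → Permutation′ n → Permutation′ n
σ · τ = τ ∘ₚ σ

prod : {n : ℕ} → List ℕ → Permutation′ n
prod [] = idₚ
prod (i ∷ w) = s i · prod w

_≟ₚ_ : {n : ℕ} → (σ τ : Permutation′ n) → Dec (All (λ x → σ ⟨$⟩ʳ x ≡ τ ⟨$⟩ʳ x) (allFin n))
_≟ₚ_ {n} σ τ = all? (λ x → (σ ⟨$⟩ʳ x) ≟F (τ ⟨$⟩ʳ x)) (allFin n)

ℓ : {n : ℕ} → Permutation′ n → ℕ
ℓ {n} σ = length (filter (λ { (a , b) → (a Data.Fin.<? b) ×-dec ((σ ⟨$⟩ʳ b) Data.Fin.<? (σ ⟨$⟩ʳ a)) })
                        (Data.List.cartesianProduct (allFin n) (allFin n)))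

letters : ℕ → List ℕ
letters n = map suc (upTo (n ∸ 1))

words : ℕ → ℕ → List (List ℕ)
words n zero = [] ∷ []
words n (suc l) = concatMap (λ i → map (i ∷_) (words n l)) (letters n)

𝓡 : {n : ℕ} → Permutation′ n → List (List ℕ)
𝓡 {n} σ = filter (λ w → prod w ≟ₚ σ) (words n (ℓ σ))

-- Des(σ) = {i ∈ [n-1] : σ(i) > σ(i+1)}, i.e. Fin-positions a, a+1 with
-- σ(a) > σ(a+1), reported as the 1-based index i = a+1
Des : {n : ℕ} → Permutation′ n → List ℕ
Des {n} σ = map (λ { (a , b) → suc (toℕ a) })
  (filter (λ { (a , b) → (toℕ b ≟ℕ suc (toℕ a)) ×-dec ((σ ⟨$⟩ʳ b) Data.Fin.<? (σ ⟨$⟩ʳ a)) })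
          (Data.List.cartesianProduct (allFin n) (allFin n)))

commMoves : List ℕ → List (List ℕ)
commMoves (a ∷ b ∷ w) = here (1 Data.Nat.<? ∣ a - b ∣) ++ map (a ∷_) (commMoves (b ∷ w))
  where
  here : Dec (1 < ∣ a - b ∣) → List (List ℕ)
  here (yes _) = (b ∷ a ∷ w) ∷ []
  here (no _) = []
commMoves _ = []

d𝓒 : {n : ℕ} → Permutation′ n → List ℕ → ℕ
d𝓒 σ v = length (filter (λ u → u ∈? commMoves v) (𝓡 σ))

totalComm : {n : ℕ} → Permutation′ n → ℕ
totalComm σ = sum (map (d𝓒 σ) (𝓡 σ))

-- Every nonempty reduced word of σ is u i with i ∈ Des(σ) and u a reduced word of σ s_i. The commutation moves
-- of u i are those of u plus one more exactly when the last letter j of u satisfies |i - j| > 1; such a j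
-- is a descent of σ s_i, equivalently of σ, and the reduced words of σ s_i ending in j are counted by
-- |𝓡(σ s_i s_j)| = |𝓡(σ s_j s_i)|. The resulting sum over pairs of far descents is symmetric, hence twice
-- the sum over pairs with i - j > 1. The length facts used are ℓ(σ s_i) = ℓ(σ) ∓ 1 according as i is or
-- is not a descent, obtained by comparing the inversions of σ and σ s_i.

module Submission where

open import Defs
open import Data.Empty using (⊥; ⊥-elim)
open import Data.Fin as Fin using (Fin; toℕ; fromℕ<)
import Data.Fin.Properties as Finₚ
open import Data.Fin.Permutation using (Permutation′; _⟨$⟩ʳ_; _⟨$⟩ˡ_; inverseˡ; _≈_) renaming (id to idₚ)
import Data.Fin.Permutation.Components as PC
open import Data.List using (List; []; _∷_; _++_; _∷ʳ_; map; concatMap; filter; length; allFin; upTo; applyUpTo; tabulate; cartesianProduct)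
open import Data.List.Properties using (≡-dec; ∷-injective; ∷-injectiveʳ; length-map; map-upTo; upTo-∷ʳ)
open import Data.List.Membership.Propositional using (_∈_; _∉_; find)
open import Data.List.Membership.Propositional.Properties using (∈-allFin; ∈-map⁻; ∈-concatMap⁻; ∈-upTo⁻; ∈-filter⁻)
open import Data.List.Relation.Unary.All as All using (All; []; _∷_)
open import Data.List.Relation.Unary.Any using (here; there)
open import Data.List.Relation.Unary.AllPairs using ([]; _∷_)
open import Data.List.Relation.Unary.Unique.Propositional using (Unique)
import Data.List.Relation.Unary.Unique.Propositional.Properties as Uniqueₚ
open import Data.Nat using (ℕ; zero; suc; _+_; _*_; _∸_; _≤_; _<_; _<?_; s≤s; z≤n; ∣_-_∣)
open import Data.Nat.ListAction using (sum)
open import Data.Nat.Properties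
open import Data.List.Membership.DecPropositional (≡-dec _≟_) using () renaming (_∈?_ to _∈ₗ?_)
import Algebra.Properties.CommutativeMonoid.Sum +-0-commutativeMonoid as FinSum
open import Algebra.Properties.CommutativeSemigroup +-commutativeSemigroup using (interchange)
open import Algebra.Properties.CommutativeSemigroup *-commutativeSemigroup using () renaming (x∙yz≈y∙xz to x*yz≡y*xz)
open import Data.Product using (_×_; _,_; proj₁; proj₂; ∃)
open import Data.Sum using (_⊎_; inj₁; inj₂; [_,_])
open import Function using (_∘_; id)
open import Level using (Level)
open import Relation.Nullary using (Dec; yes; no; ¬_)
open import Relation.Nullary.Decidable using (_×-dec_; _⊎-dec_)
open import Relation.Unary using (Decidable)
open import Relation.Binary.Definitions using (DecidableEquality)
open import Relation.Binary.PropositionalEquality using (_≡_; _≢_; refl; sym; trans; cong; cong₂; subst; subst₂; module ≡-Reasoning)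

private variable
  a b p q : Level
  A : Set a
  B : Set b
  P : Set p
  Q : Set q

𝟙 : Dec P → ℕ
𝟙 (yes _) = 1
𝟙 (no _) = 0

𝟙-cong : (P? : Dec P) (Q? : Dec Q) → (P → Q) → (Q → P) → 𝟙 P? ≡ 𝟙 Q?
𝟙-cong (yes _) (yes _) f g = refl
𝟙-cong (yes x) (no ¬y) f g = ⊥-elim (¬y (f x))
𝟙-cong (no ¬x) (yes y) f g = ⊥-elim (¬x (g y))
𝟙-cong (no _) (no _) f g = refl

𝟙-yes : (P? : Dec P) → P → 𝟙 P? ≡ 1
𝟙-yes (yes _) _ = refl
𝟙-yes (no ¬x) x = ⊥-elim (¬x x)

𝟙-no : (P? : Dec P) → ¬ P → 𝟙 P? ≡ 0
𝟙-no (yes x) ¬x = ⊥-elim (¬x x)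
𝟙-no (no _) _ = refl

𝟙-× : (P? : Dec P) (Q? : Dec Q) → 𝟙 (P? ×-dec Q?) ≡ 𝟙 P? * 𝟙 Q?
𝟙-× (yes _) (yes _) = refl
𝟙-× (yes _) (no _) = refl
𝟙-× (no _) (yes _) = refl
𝟙-× (no _) (no _) = refl

𝟙-≟-suc : (m n : ℕ) → 𝟙 (suc m ≟ suc n) ≡ 𝟙 (m ≟ n)
𝟙-≟-suc m n = 𝟙-cong (suc m ≟ suc n) (m ≟ n) suc-injective (cong suc)

∑ : List A → (A → ℕ) → ℕ
∑ xs f = sum (map f xs)

syntax ∑ xs (λ x → e) = ∑[ x ∈ xs ] e

∑-++ : (xs ys : List A) (f : A → ℕ) → ∑ (xs ++ ys) f ≡ ∑ xs f + ∑ ys f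
∑-++ [] ys f = refl
∑-++ (x ∷ xs) ys f = trans (cong (f x +_) (∑-++ xs ys f)) (sym (+-assoc (f x) _ _))

∑-cong-∈ : (xs : List A) {f g : A → ℕ} → (∀ x → x ∈ xs → f x ≡ g x) → ∑ xs f ≡ ∑ xs g
∑-cong-∈ [] h = refl
∑-cong-∈ (x ∷ xs) h = cong₂ _+_ (h x (here refl)) (∑-cong-∈ xs (λ y y∈xs → h y (there y∈xs)))

∑-cong : (xs : List A) {f g : A → ℕ} → (∀ x → f x ≡ g x) → ∑ xs f ≡ ∑ xs g
∑-cong xs h = ∑-cong-∈ xs (λ x _ → h x)

∑-≡0 : (xs : List A) (f : A → ℕ) → (∀ x → x ∈ xs → f x ≡ 0) → ∑ xs f ≡ 0
∑-≡0 [] f h = refl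
∑-≡0 (x ∷ xs) f h = cong₂ _+_ (h x (here refl)) (∑-≡0 xs f (λ y y∈xs → h y (there y∈xs)))

∑-distrib-+ : (xs : List A) (f g : A → ℕ) → ∑[ x ∈ xs ] (f x + g x) ≡ ∑ xs f + ∑ xs g
∑-distrib-+ [] f g = refl
∑-distrib-+ (x ∷ xs) f g = trans (cong (f x + g x +_) (∑-distrib-+ xs f g)) (interchange (f x) (g x) _ _)

∑-*ˡ : (xs : List A) (c : ℕ) (f : A → ℕ) → ∑[ x ∈ xs ] (c * f x) ≡ c * ∑ xs f
∑-*ˡ [] c f = sym (*-zeroʳ c)
∑-*ˡ (x ∷ xs) c f = trans (cong (c * f x +_) (∑-*ˡ xs c f)) (sym (*-distribˡ-+ c (f x) _))

∑-comm : (xs : List A) (ys : List B) (f : A → B → ℕ) →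
         ∑[ x ∈ xs ] ∑[ y ∈ ys ] f x y ≡ ∑[ y ∈ ys ] ∑[ x ∈ xs ] f x y
∑-comm [] ys f = sym (∑-≡0 ys (λ _ → 0) (λ _ _ → refl))
∑-comm (x ∷ xs) ys f = trans (cong (∑ ys (f x) +_) (∑-comm xs ys f)) (sym (∑-distrib-+ ys (f x) _))

∑-map : (xs : List A) (g : A → B) (f : B → ℕ) → ∑ (map g xs) f ≡ ∑ xs (f ∘ g)
∑-map [] g f = refl
∑-map (x ∷ xs) g f = cong (f (g x) +_) (∑-map xs g f)

∑-concatMap : (xs : List A) (g : A → List B) (f : B → ℕ) → ∑ (concatMap g xs) f ≡ ∑[ x ∈ xs ] ∑ (g x) f
∑-concatMap [] g f = refl
∑-concatMap (x ∷ xs) g f = trans (∑-++ (g x) _ f) (cong (∑ (g x) f +_) (∑-concatMap xs g f))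

∑-cartesianProduct : (xs : List A) (ys : List B) (f : A × B → ℕ) →
                     ∑ (cartesianProduct xs ys) f ≡ ∑[ x ∈ xs ] ∑[ y ∈ ys ] f (x , y)
∑-cartesianProduct [] ys f = refl
∑-cartesianProduct (x ∷ xs) ys f =
  trans (∑-++ (map (x ,_) ys) _ f) (cong₂ _+_ (∑-map ys (x ,_) f) (∑-cartesianProduct xs ys f))

∑-filter : {P : A → Set p} (P? : Decidable P) (xs : List A) (f : A → ℕ) →
           ∑ (filter P? xs) f ≡ ∑[ x ∈ xs ] (𝟙 (P? x) * f x)
∑-filter P? [] f = refl
∑-filter P? (x ∷ xs) f with P? x
... | yes _ = cong₂ _+_ (sym (+-identityʳ (f x))) (∑-filter P? xs f)
... | no _ = ∑-filter P? xs f

∑-const : (xs : List A) (c : ℕ) → ∑[ x ∈ xs ] c ≡ length xs * c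
∑-const [] c = refl
∑-const (x ∷ xs) c = cong (c +_) (∑-const xs c)

length≡∑1 : (xs : List A) → length xs ≡ ∑[ x ∈ xs ] 1
length≡∑1 [] = refl
length≡∑1 (x ∷ xs) = cong suc (length≡∑1 xs)

length-filter≡∑𝟙 : {P : A → Set p} (P? : Decidable P) (xs : List A) → length (filter P? xs) ≡ ∑[ x ∈ xs ] 𝟙 (P? x)
length-filter≡∑𝟙 P? xs = trans (length≡∑1 (filter P? xs)) (trans (∑-filter P? xs (λ _ → 1))
  (∑-cong xs (λ x → *-identityʳ (𝟙 (P? x)))))

∑∑-distrib-+ : (xs : List A) (ys : List B) (f g : A → B → ℕ) →
  ∑[ x ∈ xs ] ∑[ y ∈ ys ] (f x y + g x y) ≡ ∑[ x ∈ xs ] ∑[ y ∈ ys ] f x y + ∑[ x ∈ xs ] ∑[ y ∈ ys ] g x y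
∑∑-distrib-+ xs ys f g = trans (∑-cong xs (λ x → ∑-distrib-+ ys (f x) (g x))) (∑-distrib-+ xs _ _)

∑∑-pull-weights : (xs : List A) (ys : List B) (a : A → ℕ) (b : B → ℕ) (c f : A → B → ℕ) →
  ∑[ x ∈ xs ] (a x * ∑[ y ∈ ys ] (b y * (c x y * f x y))) ≡ ∑[ x ∈ xs ] ∑[ y ∈ ys ] (c x y * (a x * (b y * f x y)))
∑∑-pull-weights xs ys a b c f = ∑-cong xs (λ x → trans (sym (∑-*ˡ ys (a x) _)) (∑-cong ys (λ y →
  trans (cong (a x *_) (x*yz≡y*xz (b y) (c x y) (f x y))) (x*yz≡y*xz (a x) (c x y) (b y * f x y)))))

module _ {A : Set a} (_≟ᴬ_ : DecidableEquality A) where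

  open import Data.List.Membership.DecPropositional _≟ᴬ_ using (_∈?_)

  ∑-δ-∉ : {xs : List A} {x : A} → x ∉ xs → (f : A → ℕ) → ∑[ y ∈ xs ] (𝟙 (y ≟ᴬ x) * f y) ≡ 0
  ∑-δ-∉ {[]} x∉xs f = refl
  ∑-δ-∉ {y ∷ ys} {x} x∉xs f =
    cong₂ _+_ (cong (_* f y) (𝟙-no (y ≟ᴬ x) (λ y≡x → x∉xs (here (sym y≡x))))) (∑-δ-∉ (x∉xs ∘ there) f)

  ∑-δ : {xs : List A} {x : A} → Unique xs → x ∈ xs → (f : A → ℕ) → ∑[ y ∈ xs ] (𝟙 (y ≟ᴬ x) * f y) ≡ f x
  ∑-δ {x ∷ ys} (x∉ys ∷ _) (here refl) f = begin
    𝟙 (x ≟ᴬ x) * f x + ∑[ y ∈ ys ] (𝟙 (y ≟ᴬ x) * f y)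
      ≡⟨ cong₂ _+_ (cong (_* f x) (𝟙-yes (x ≟ᴬ x) refl)) (∑-δ-∉ (λ x∈ys → All.lookup x∉ys x∈ys refl) f) ⟩
    1 * f x + 0
      ≡⟨ trans (+-identityʳ _) (*-identityˡ (f x)) ⟩
    f x ∎
    where open ≡-Reasoning
  ∑-δ {y ∷ ys} {x} (y∉ys ∷ ys!) (there x∈ys) f =
    cong₂ _+_ (cong (_* f y) (𝟙-no (y ≟ᴬ x) (All.lookup y∉ys x∈ys))) (∑-δ ys! x∈ys f)

  𝟙-∈?≡∑𝟙-≟ : {ys : List A} → Unique ys → (x : A) → 𝟙 (x ∈? ys) ≡ ∑[ y ∈ ys ] 𝟙 (x ≟ᴬ y)
  𝟙-∈?≡∑𝟙-≟ [] x = refl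
  𝟙-∈?≡∑𝟙-≟ {y ∷ ys} (y∉ys ∷ ys!) x = trans (head-or-tail (x ≟ᴬ y)) (cong (𝟙 (x ≟ᴬ y) +_) (𝟙-∈?≡∑𝟙-≟ ys! x))
    where
    head-or-tail : (x≟y : Dec (x ≡ y)) → 𝟙 (x ∈? (y ∷ ys)) ≡ 𝟙 x≟y + 𝟙 (x ∈? ys)
    head-or-tail (yes refl) = trans (𝟙-yes (x ∈? (x ∷ ys)) (here refl))
                                    (cong suc (sym (𝟙-no (x ∈? ys) (λ x∈ys → All.lookup y∉ys x∈ys refl))))
    head-or-tail (no x≢y) = 𝟙-cong (x ∈? (y ∷ ys)) (x ∈? ys) (λ { (here x≡y) → ⊥-elim (x≢y x≡y) ; (there x∈ys) → x∈ys }) there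

∑-tabulate : (n : ℕ) (g : Fin n → A) (f : A → ℕ) → ∑ (tabulate g) f ≡ FinSum.sum (f ∘ g)
∑-tabulate zero g f = refl
∑-tabulate (suc n) g f = cong (f (g Fin.zero) +_) (∑-tabulate n (g ∘ Fin.suc) f)

∑-allFin-suc : (n : ℕ) (f : Fin (suc n) → ℕ) → ∑ (allFin (suc n)) f ≡ f Fin.zero + ∑ (allFin n) (f ∘ Fin.suc)
∑-allFin-suc n f = cong (f Fin.zero +_) (trans (∑-tabulate n Fin.suc f) (sym (∑-tabulate n id (f ∘ Fin.suc))))

∑-allFin-permute : (n : ℕ) (π : Permutation′ n) (f : Fin n → ℕ) → ∑ (allFin n) f ≡ ∑[ x ∈ allFin n ] f (π ⟨$⟩ʳ x)
∑-allFin-permute n π f =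
  trans (∑-tabulate n id f) (trans (FinSum.sum-permute f π) (sym (∑-tabulate n id (λ x → f (π ⟨$⟩ʳ x)))))

∑-allFin-toℕ : (n : ℕ) (φ : ℕ → ℕ) → ∑[ x ∈ allFin n ] φ (toℕ x) ≡ ∑ (upTo n) φ
∑-allFin-toℕ zero φ = refl
∑-allFin-toℕ (suc n) φ = trans (∑-allFin-suc n (φ ∘ toℕ)) (cong (φ 0 +_) (begin
  ∑[ x ∈ allFin n ] φ (suc (toℕ x))  ≡⟨ ∑-allFin-toℕ n (φ ∘ suc) ⟩
  ∑ (upTo n) (φ ∘ suc)                ≡⟨ ∑-map (upTo n) suc φ ⟨
  ∑ (map suc (upTo n)) φ              ≡⟨ cong (λ xs → ∑ xs φ) (map-upTo suc n) ⟩
  ∑ (applyUpTo suc n) φ               ∎))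
  where open ≡-Reasoning

∑-allFin-δ : (n m : ℕ) (f : Fin n → ℕ) (m<n : m < n) → ∑[ x ∈ allFin n ] (𝟙 (toℕ x ≟ m) * f x) ≡ f (fromℕ< m<n)
∑-allFin-δ (suc n) zero f _ = trans (∑-allFin-suc n _)
  (trans (cong₂ _+_ (+-identityʳ (f Fin.zero)) (∑-≡0 (allFin n) _ (λ _ _ → refl))) (+-identityʳ _))
∑-allFin-δ (suc n) (suc m) f (s≤s m<n) = trans (∑-allFin-suc n (λ x → 𝟙 (toℕ x ≟ suc m) * f x))
  (trans (∑-cong (allFin n) (λ x → cong (_* f (Fin.suc x)) (𝟙-≟-suc (toℕ x) m)))
         (∑-allFin-δ n m (f ∘ Fin.suc) m<n))

∑-allFin-δ-out : (n m : ℕ) (f : Fin n → ℕ) → ¬ m < n → ∑[ x ∈ allFin n ] (𝟙 (toℕ x ≟ m) * f x) ≡ 0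
∑-allFin-δ-out zero m f _ = refl
∑-allFin-δ-out (suc n) zero f m≮n = ⊥-elim (m≮n (s≤s z≤n))
∑-allFin-δ-out (suc n) (suc m) f m≮n = trans (∑-allFin-suc n (λ x → 𝟙 (toℕ x ≟ suc m) * f x))
  (trans (∑-cong (allFin n) (λ x → cong (_* f (Fin.suc x)) (𝟙-≟-suc (toℕ x) m)))
         (∑-allFin-δ-out n m (f ∘ Fin.suc) (m≮n ∘ s≤s)))

∑∑-allFin-δ : (n k m : ℕ) (f : Fin n → Fin n → ℕ) (k<n : k < n) (m<n : m < n) →
  ∑[ x ∈ allFin n ] ∑[ y ∈ allFin n ] (𝟙 ((toℕ x ≟ k) ×-dec (toℕ y ≟ m)) * f x y) ≡ f (fromℕ< k<n) (fromℕ< m<n)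
∑∑-allFin-δ n k m f k<n m<n = begin
  ∑[ x ∈ allFin n ] ∑[ y ∈ allFin n ] (𝟙 ((toℕ x ≟ k) ×-dec (toℕ y ≟ m)) * f x y)
    ≡⟨ ∑-cong (allFin n) (λ x → ∑-cong (allFin n) (λ y → trans (cong (_* f x y) (𝟙-× (toℕ x ≟ k) (toℕ y ≟ m)))
         (*-assoc (𝟙 (toℕ x ≟ k)) _ _))) ⟩
  ∑[ x ∈ allFin n ] ∑[ y ∈ allFin n ] (𝟙 (toℕ x ≟ k) * (𝟙 (toℕ y ≟ m) * f x y))
    ≡⟨ ∑-cong (allFin n) (λ x → trans (∑-*ˡ (allFin n) (𝟙 (toℕ x ≟ k)) _)
         (cong (𝟙 (toℕ x ≟ k) *_) (∑-allFin-δ n m (f x) m<n))) ⟩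
  ∑[ x ∈ allFin n ] (𝟙 (toℕ x ≟ k) * f x (fromℕ< m<n))
    ≡⟨ ∑-allFin-δ n k (λ x → f x (fromℕ< m<n)) k<n ⟩
  f (fromℕ< k<n) (fromℕ< m<n) ∎
  where open ≡-Reasoning

≈-fromAll : {n : ℕ} {σ τ : Permutation′ n} → All (λ x → σ ⟨$⟩ʳ x ≡ τ ⟨$⟩ʳ x) (allFin n) → σ ≈ τ
≈-fromAll eqs x = All.lookup eqs (∈-allFin x)

≈-toAll : {n : ℕ} {σ τ : Permutation′ n} → σ ≈ τ → All (λ x → σ ⟨$⟩ʳ x ≡ τ ⟨$⟩ʳ x) (allFin n)
≈-toAll σ≈τ = All.tabulate (λ {x} _ → σ≈τ x)

𝟙-≟ₚ-yes : {n : ℕ} {σ τ : Permutation′ n} → σ ≈ τ → 𝟙 (σ ≟ₚ τ) ≡ 1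
𝟙-≟ₚ-yes {σ = σ} {τ} σ≈τ = 𝟙-yes (σ ≟ₚ τ) (≈-toAll {σ = σ} {τ} σ≈τ)

𝟙-≟ₚ-cong : {n : ℕ} {σ σ′ τ τ′ : Permutation′ n} → σ ≈ σ′ → τ ≈ τ′ → 𝟙 (σ ≟ₚ τ) ≡ 𝟙 (σ′ ≟ₚ τ′)
𝟙-≟ₚ-cong {σ = σ} {σ′} {τ} {τ′} σ≈σ′ τ≈τ′ = 𝟙-cong (σ ≟ₚ τ) (σ′ ≟ₚ τ′)
  (λ eqs → ≈-toAll {σ = σ′} {τ′} (λ x → trans (sym (σ≈σ′ x)) (trans (≈-fromAll {σ = σ} {τ} eqs x) (τ≈τ′ x))))
  (λ eqs → ≈-toAll {σ = σ} {τ} (λ x → trans (σ≈σ′ x) (trans (≈-fromAll {σ = σ′} {τ′} eqs x) (sym (τ≈τ′ x)))))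

⟨$⟩ʳ-injective : {n : ℕ} (σ : Permutation′ n) {x y : Fin n} → σ ⟨$⟩ʳ x ≡ σ ⟨$⟩ʳ y → x ≡ y
⟨$⟩ʳ-injective σ {x} {y} eq = trans (sym (inverseˡ σ)) (trans (cong (σ ⟨$⟩ˡ_) eq) (inverseˡ σ))

transpose-matchˡ : {n : ℕ} (i j : Fin n) → PC.transpose i j i ≡ j
transpose-matchˡ i j with i Fin.≟ i
... | yes _ = refl
... | no i≢i = ⊥-elim (i≢i refl)

transpose-matchʳ : {n : ℕ} (i j : Fin n) → PC.transpose i j j ≡ i
transpose-matchʳ i j with j Fin.≟ i
... | yes j≡i = j≡i
... | no _ with j Fin.≟ j
...   | yes _ = refl
...   | no j≢j = ⊥-elim (j≢j refl)

transpose-mismatch : {n : ℕ} (i j k : Fin n) → k ≢ i → k ≢ j → PC.transpose i j k ≡ k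
transpose-mismatch i j k k≢i k≢j with k Fin.≟ i
... | yes k≡i = ⊥-elim (k≢i k≡i)
... | no _ with k Fin.≟ j
...   | yes k≡j = ⊥-elim (k≢j k≡j)
...   | no _ = refl

transpose-involutive : {n : ℕ} (i j k : Fin n) → PC.transpose i j (PC.transpose i j k) ≡ k
transpose-involutive i j k with k Fin.≟ i
... | yes refl = transpose-matchʳ k j
... | no k≢i with k Fin.≟ j
...   | yes refl = transpose-matchˡ i k
...   | no k≢j = transpose-mismatch i j k k≢i k≢j

lower : {n : ℕ} (k : ℕ) → suc k < n → Fin n
lower k k+1<n = fromℕ< (<-trans (n<1+n k) k+1<n)

upper : {n : ℕ} (k : ℕ) → suc k < n → Fin n
upper k k+1<n = fromℕ< k+1<n

toℕ-lower : {n : ℕ} (k : ℕ) (k+1<n : suc k < n) → toℕ (lower k k+1<n) ≡ k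
toℕ-lower k k+1<n = Finₚ.toℕ-fromℕ< _

toℕ-upper : {n : ℕ} (k : ℕ) (k+1<n : suc k < n) → toℕ (upper k k+1<n) ≡ suc k
toℕ-upper k k+1<n = Finₚ.toℕ-fromℕ< _

s-suc : {n : ℕ} (k : ℕ) (k+1<n : suc k < n) (x : Fin n) →
        s {n} (suc k) ⟨$⟩ʳ x ≡ PC.transpose (lower k k+1<n) (upper k k+1<n) x
s-suc {n} k k+1<n x with suc k <? n
... | yes _ = refl
... | no k+1≮n = ⊥-elim (k+1≮n k+1<n)

s-suc-out : {n : ℕ} (k : ℕ) → ¬ suc k < n → (x : Fin n) → s {n} (suc k) ⟨$⟩ʳ x ≡ x
s-suc-out {n} k k+1≮n x with suc k <? n
... | yes k+1<n = ⊥-elim (k+1≮n k+1<n)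
... | no _ = refl

s-involutive : {n : ℕ} (i : ℕ) → s {n} i · s i ≈ idₚ
s-involutive zero x = refl
s-involutive {n} (suc k) x with suc k <? n
... | yes _ = transpose-involutive _ _ x
... | no _ = refl

prod-∷ʳ : {n : ℕ} (u : List ℕ) (i : ℕ) → prod {n} (u ∷ʳ i) ≈ prod u · s i
prod-∷ʳ [] i x = refl
prod-∷ʳ (a ∷ u) i x = cong (s a ⟨$⟩ʳ_) (prod-∷ʳ u i x)

𝟙-prod-∷ʳ : {n : ℕ} (u : List ℕ) (i : ℕ) (σ : Permutation′ n) → 𝟙 (prod (u ∷ʳ i) ≟ₚ σ) ≡ 𝟙 (prod u ≟ₚ (σ · s i))
𝟙-prod-∷ʳ {n} u i σ = 𝟙-cong (prod (u ∷ʳ i) ≟ₚ σ) (prod u ≟ₚ (σ · s i))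
  (λ eqs → ≈-toAll {σ = prod u} {σ · s i} (λ x → begin
    prod u ⟨$⟩ʳ x                          ≡⟨ cong (prod u ⟨$⟩ʳ_) (s-involutive i x) ⟨
    prod u ⟨$⟩ʳ (s i ⟨$⟩ʳ (s i ⟨$⟩ʳ x))    ≡⟨ prod-∷ʳ u i (s i ⟨$⟩ʳ x) ⟨
    prod (u ∷ʳ i) ⟨$⟩ʳ (s i ⟨$⟩ʳ x)        ≡⟨ ≈-fromAll {σ = prod (u ∷ʳ i)} {σ} eqs (s i ⟨$⟩ʳ x) ⟩
    σ ⟨$⟩ʳ (s i ⟨$⟩ʳ x)                    ∎))
  (λ eqs → ≈-toAll {σ = prod (u ∷ʳ i)} {σ} (λ x → begin
    prod (u ∷ʳ i) ⟨$⟩ʳ x                   ≡⟨ prod-∷ʳ u i x ⟩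
    prod u ⟨$⟩ʳ (s i ⟨$⟩ʳ x)               ≡⟨ ≈-fromAll {σ = prod u} {σ · s i} eqs (s i ⟨$⟩ʳ x) ⟩
    σ ⟨$⟩ʳ (s i ⟨$⟩ʳ (s i ⟨$⟩ʳ x))         ≡⟨ cong (σ ⟨$⟩ʳ_) (s-involutive i x) ⟩
    σ ⟨$⟩ʳ x                               ∎))
  where open ≡-Reasoning

-- Length

ℓ≡∑∑ : {n : ℕ} (σ : Permutation′ n) →
  ℓ σ ≡ ∑[ x ∈ allFin n ] ∑[ y ∈ allFin n ] (𝟙 (x Fin.<? y) * 𝟙 (σ ⟨$⟩ʳ y Fin.<? σ ⟨$⟩ʳ x))
ℓ≡∑∑ {n} σ = trans (length-filter≡∑𝟙 _ (cartesianProduct (allFin n) (allFin n)))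
  (trans (∑-cartesianProduct (allFin n) (allFin n) _)
         (∑-cong (allFin n) (λ x → ∑-cong (allFin n) (λ y → 𝟙-× (x Fin.<? y) (σ ⟨$⟩ʳ y Fin.<? σ ⟨$⟩ʳ x)))))

ℓ-cong : {n : ℕ} {σ τ : Permutation′ n} → σ ≈ τ → ℓ σ ≡ ℓ τ
ℓ-cong {n} {σ} {τ} σ≈τ = trans (ℓ≡∑∑ σ) (trans (∑-cong (allFin n) (λ x → ∑-cong (allFin n) (λ y →
  cong (𝟙 (x Fin.<? y) *_) (𝟙-cong (σ ⟨$⟩ʳ y Fin.<? σ ⟨$⟩ʳ x) (τ ⟨$⟩ʳ y Fin.<? τ ⟨$⟩ʳ x)
    (subst₂ Fin._<_ (σ≈τ y) (σ≈τ x)) (subst₂ Fin._<_ (sym (σ≈τ y)) (sym (σ≈τ x)))))))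
  (sym (ℓ≡∑∑ τ)))

ℓ-id : {n : ℕ} → ℓ (idₚ {n}) ≡ 0
ℓ-id {n} = trans (ℓ≡∑∑ (idₚ {n})) (∑-≡0 (allFin n) _ (λ x _ → ∑-≡0 (allFin n) _ (λ y _ → no-inversion x y)))
  where
  no-inversion : (x y : Fin n) → 𝟙 (x Fin.<? y) * 𝟙 (y Fin.<? x) ≡ 0
  no-inversion x y with x Fin.<? y
  ... | no _ = refl
  ... | yes x<y = cong (1 *_) (𝟙-no (y Fin.<? x) (<-asym x<y))

swap : ℕ → ℕ → ℕ
swap k X with X ≟ k
... | yes _ = suc k
... | no _ with X ≟ suc k
...   | yes _ = k
...   | no _ = X

swap-k : (k : ℕ) → swap k k ≡ suc k
swap-k k with k ≟ k
... | yes _ = refl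
... | no k≢k = ⊥-elim (k≢k refl)

swap-suc-k : (k : ℕ) → swap k (suc k) ≡ k
swap-suc-k k with suc k ≟ k
... | yes k+1≡k = ⊥-elim (<-irrefl (sym k+1≡k) (n<1+n k))
... | no _ with suc k ≟ suc k
...   | yes _ = refl
...   | no k+1≢k+1 = ⊥-elim (k+1≢k+1 refl)

swap-<-iff : (k X Y : ℕ) → ¬ (X ≡ k × Y ≡ suc k) → ¬ (X ≡ suc k × Y ≡ k) →
             (swap k X < swap k Y → X < Y) × (X < Y → swap k X < swap k Y)
swap-<-iff k X Y ¬kk+1 ¬k+1k with X ≟ k | Y ≟ k
... | yes refl | yes refl = (λ q → ⊥-elim (n≮n _ q)) , (λ q → ⊥-elim (n≮n _ q))
... | yes refl | no Y≢k with Y ≟ suc k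
...   | yes refl = ⊥-elim (¬kk+1 (refl , refl))
...   | no Y≢k+1 = (λ q → <-trans (n<1+n k) q) , (λ q → ≤∧≢⇒< q (Y≢k+1 ∘ sym))
swap-<-iff k X Y ¬kk+1 ¬k+1k | no X≢k | yes refl with X ≟ suc k
... | yes refl = ⊥-elim (¬k+1k (refl , refl))
... | no X≢k+1 = (λ q → ≤∧≢⇒< (m<1+n⇒m≤n q) X≢k) , m<n⇒m<1+n
swap-<-iff k X Y ¬kk+1 ¬k+1k | no X≢k | no Y≢k with X ≟ suc k | Y ≟ suc k
... | yes refl | yes refl = (λ q → ⊥-elim (n≮n _ q)) , (λ q → ⊥-elim (n≮n _ q))
... | yes refl | no Y≢k+1 = (λ q → ≤∧≢⇒< q (Y≢k+1 ∘ sym)) , (λ q → <-trans (n<1+n k) q)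
... | no X≢k+1 | yes refl = m<n⇒m<1+n , (λ q → ≤∧≢⇒< (m<1+n⇒m≤n q) X≢k)
... | no X≢k+1 | no Y≢k+1 = id , id

𝟙-swap-< : (k X Y : ℕ) →
  𝟙 (swap k X <? swap k Y) + 𝟙 ((X ≟ k) ×-dec (Y ≟ suc k)) ≡ 𝟙 (X <? Y) + 𝟙 ((X ≟ suc k) ×-dec (Y ≟ k))
𝟙-swap-< k X Y with (X ≟ k) ×-dec (Y ≟ suc k) | (X ≟ suc k) ×-dec (Y ≟ k)
... | yes (refl , refl) | k+1k? rewrite swap-k k | swap-suc-k k =
  trans (cong (_+ 1) (𝟙-no (suc k <? k) (<-asym (n<1+n k))))
        (sym (cong₂ _+_ (𝟙-yes (k <? suc k) (n<1+n k)) (𝟙-no k+1k? λ (k≡k+1 , _) → <-irrefl k≡k+1 (n<1+n k))))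
... | no _ | yes (refl , refl) rewrite swap-k k | swap-suc-k k =
  trans (+-identityʳ _) (trans (𝟙-yes (k <? suc k) (n<1+n k)) (sym (cong (_+ 1) (𝟙-no (suc k <? k) (<-asym (n<1+n k))))))
... | no ¬kk+1 | no ¬k+1k = cong (_+ 0) (𝟙-cong (swap k X <? swap k Y) (X <? Y)
  (proj₁ (swap-<-iff k X Y ¬kk+1 ¬k+1k)) (proj₂ (swap-<-iff k X Y ¬kk+1 ¬k+1k)))

toℕ-s-suc : {n : ℕ} (k : ℕ) (k+1<n : suc k < n) (x : Fin n) → toℕ (s {n} (suc k) ⟨$⟩ʳ x) ≡ swap k (toℕ x)
toℕ-s-suc k k+1<n x rewrite s-suc k k+1<n x with toℕ x ≟ k
... | yes x≡k = begin
  toℕ (PC.transpose lo hi x)   ≡⟨ cong (toℕ ∘ PC.transpose lo hi) (Finₚ.toℕ-injective (trans x≡k (sym (toℕ-lower k k+1<n)))) ⟩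
  toℕ (PC.transpose lo hi lo)  ≡⟨ cong toℕ (transpose-matchˡ lo hi) ⟩
  toℕ hi                       ≡⟨ toℕ-upper k k+1<n ⟩
  suc k                        ∎
  where
  open ≡-Reasoning
  lo = lower k k+1<n
  hi = upper k k+1<n
... | no x≢k with toℕ x ≟ suc k
...   | yes x≡k+1 = begin
  toℕ (PC.transpose lo hi x)   ≡⟨ cong (toℕ ∘ PC.transpose lo hi) (Finₚ.toℕ-injective (trans x≡k+1 (sym (toℕ-upper k k+1<n)))) ⟩
  toℕ (PC.transpose lo hi hi)  ≡⟨ cong toℕ (transpose-matchʳ lo hi) ⟩
  toℕ lo                       ≡⟨ toℕ-lower k k+1<n ⟩
  k                            ∎
  where
  open ≡-Reasoning
  lo = lower k k+1<n
  hi = upper k k+1<n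
...   | no x≢k+1 = cong toℕ (transpose-mismatch _ _ x
  (λ x≡lo → x≢k (trans (cong toℕ x≡lo) (toℕ-lower k k+1<n)))
  (λ x≡hi → x≢k+1 (trans (cong toℕ x≡hi) (toℕ-upper k k+1<n))))

module _ {n : ℕ} (σ : Permutation′ n) (k : ℕ) (k+1<n : suc k < n) where

  private
    S : Permutation′ n
    S = s {n} (suc k)

    lo hi : Fin n
    lo = lower k k+1<n
    hi = upper k k+1<n

    c : Fin n → Fin n → ℕ
    c x y = 𝟙 (σ ⟨$⟩ʳ y Fin.<? σ ⟨$⟩ʳ x)

    ℓ-·s≡∑∑-swap : ℓ (σ · S) ≡ ∑[ x ∈ allFin n ] ∑[ y ∈ allFin n ] (𝟙 (swap k (toℕ x) <? swap k (toℕ y)) * c x y)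
    ℓ-·s≡∑∑-swap = trans (ℓ≡∑∑ (σ · S)) (trans (∑-allFin-permute n S _) (∑-cong (allFin n) (λ x →
      trans (∑-allFin-permute n S _) (∑-cong (allFin n) (λ y → cong₂ _*_
        (𝟙-cong (S ⟨$⟩ʳ x Fin.<? S ⟨$⟩ʳ y) (swap k (toℕ x) <? swap k (toℕ y))
          (subst₂ _<_ (toℕ-s-suc k k+1<n x) (toℕ-s-suc k k+1<n y))
          (subst₂ _<_ (sym (toℕ-s-suc k k+1<n x)) (sym (toℕ-s-suc k k+1<n y))))
        (cong₂ (λ u v → 𝟙 (σ ⟨$⟩ʳ u Fin.<? σ ⟨$⟩ʳ v)) (s-involutive (suc k) y) (s-involutive (suc k) x)))))))

  -- Reindexing the inversions of σ s_i by s_i changes only the comparison of the two positions s_i swaps.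
  ℓ-·s-balance : ℓ (σ · s (suc k)) + 𝟙 (σ ⟨$⟩ʳ hi Fin.<? σ ⟨$⟩ʳ lo) ≡ ℓ σ + 𝟙 (σ ⟨$⟩ʳ lo Fin.<? σ ⟨$⟩ʳ hi)
  ℓ-·s-balance = begin
    ℓ (σ · S) + c lo hi
      ≡⟨ cong₂ _+_ ℓ-·s≡∑∑-swap (sym (∑∑-allFin-δ n k (suc k) c (<-trans (n<1+n k) k+1<n) k+1<n)) ⟩
    ∑∑ (λ x y → 𝟙 (swap k (toℕ x) <? swap k (toℕ y))) + ∑∑ (λ x y → 𝟙 ((toℕ x ≟ k) ×-dec (toℕ y ≟ suc k)))
      ≡⟨ ∑∑-+ (λ x y → 𝟙 (swap k (toℕ x) <? swap k (toℕ y))) (λ x y → 𝟙 ((toℕ x ≟ k) ×-dec (toℕ y ≟ suc k))) ⟨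
    ∑∑ (λ x y → 𝟙 (swap k (toℕ x) <? swap k (toℕ y)) + 𝟙 ((toℕ x ≟ k) ×-dec (toℕ y ≟ suc k)))
      ≡⟨ ∑-cong (allFin n) (λ x → ∑-cong (allFin n) (λ y → cong (_* c x y) (𝟙-swap-< k (toℕ x) (toℕ y)))) ⟩
    ∑∑ (λ x y → 𝟙 (x Fin.<? y) + 𝟙 ((toℕ x ≟ suc k) ×-dec (toℕ y ≟ k)))
      ≡⟨ ∑∑-+ (λ x y → 𝟙 (x Fin.<? y)) (λ x y → 𝟙 ((toℕ x ≟ suc k) ×-dec (toℕ y ≟ k))) ⟩
    ∑∑ (λ x y → 𝟙 (x Fin.<? y)) + ∑∑ (λ x y → 𝟙 ((toℕ x ≟ suc k) ×-dec (toℕ y ≟ k)))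
      ≡⟨ cong₂ _+_ (sym (ℓ≡∑∑ σ)) (∑∑-allFin-δ n (suc k) k c k+1<n (<-trans (n<1+n k) k+1<n)) ⟩
    ℓ σ + c hi lo ∎
    where
    open ≡-Reasoning
    ∑∑ : (Fin n → Fin n → ℕ) → ℕ
    ∑∑ w = ∑[ x ∈ allFin n ] ∑[ y ∈ allFin n ] (w x y * c x y)
    ∑∑-+ : (f g : Fin n → Fin n → ℕ) → ∑∑ (λ x y → f x y + g x y) ≡ ∑∑ f + ∑∑ g
    ∑∑-+ f g = trans (∑-cong (allFin n) (λ x → ∑-cong (allFin n) (λ y → *-distribʳ-+ (c x y) (f x y) (g x y))))
                     (∑∑-distrib-+ (allFin n) (allFin n) _ _)

  ℓ-·s-descent : σ ⟨$⟩ʳ hi Fin.< σ ⟨$⟩ʳ lo → suc (ℓ (σ · s (suc k))) ≡ ℓ σ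
  ℓ-·s-descent σhi<σlo = begin
    suc (ℓ (σ · S))     ≡⟨ +-comm 1 _ ⟩
    ℓ (σ · S) + 1       ≡⟨ cong (ℓ (σ · S) +_) (𝟙-yes (σ ⟨$⟩ʳ hi Fin.<? σ ⟨$⟩ʳ lo) σhi<σlo) ⟨
    ℓ (σ · S) + c lo hi ≡⟨ ℓ-·s-balance ⟩
    ℓ σ + c hi lo       ≡⟨ cong (ℓ σ +_) (𝟙-no (σ ⟨$⟩ʳ lo Fin.<? σ ⟨$⟩ʳ hi) (<-asym σhi<σlo)) ⟩
    ℓ σ + 0             ≡⟨ +-identityʳ _ ⟩
    ℓ σ                 ∎
    where open ≡-Reasoning

  ℓ-·s-ascent : ¬ σ ⟨$⟩ʳ hi Fin.< σ ⟨$⟩ʳ lo → ℓ (σ · s (suc k)) ≡ suc (ℓ σ)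
  ℓ-·s-ascent σhi≮σlo = begin
    ℓ (σ · S)           ≡⟨ +-identityʳ _ ⟨
    ℓ (σ · S) + 0       ≡⟨ cong (ℓ (σ · S) +_) (𝟙-no (σ ⟨$⟩ʳ hi Fin.<? σ ⟨$⟩ʳ lo) σhi≮σlo) ⟨
    ℓ (σ · S) + c lo hi ≡⟨ ℓ-·s-balance ⟩
    ℓ σ + c hi lo       ≡⟨ cong (ℓ σ +_) (𝟙-yes (σ ⟨$⟩ʳ lo Fin.<? σ ⟨$⟩ʳ hi) σlo<σhi) ⟩
    ℓ σ + 1             ≡⟨ +-comm _ 1 ⟩
    suc (ℓ σ)           ∎
    where
    open ≡-Reasoning
    lo≢hi : lo ≢ hi
    lo≢hi lo≡hi = <-irrefl (trans (sym (toℕ-lower k k+1<n)) (trans (cong toℕ lo≡hi) (toℕ-upper k k+1<n))) (n<1+n k)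
    σlo<σhi : σ ⟨$⟩ʳ lo Fin.< σ ⟨$⟩ʳ hi
    σlo<σhi = ≤∧≢⇒< (≮⇒≥ σhi≮σlo) (λ eq → lo≢hi (⟨$⟩ʳ-injective σ (Finₚ.toℕ-injective eq)))

-- Descents

𝟙Des : {n : ℕ} → Permutation′ n → ℕ → ℕ
𝟙Des σ zero = 0
𝟙Des {n} σ (suc k) with suc k <? n
... | yes k+1<n = 𝟙 (σ ⟨$⟩ʳ upper k k+1<n Fin.<? σ ⟨$⟩ʳ lower k k+1<n)
... | no _ = 0

𝟙Des-suc : {n : ℕ} (σ : Permutation′ n) (k : ℕ) (k+1<n : suc k < n) →
           𝟙Des σ (suc k) ≡ 𝟙 (σ ⟨$⟩ʳ upper k k+1<n Fin.<? σ ⟨$⟩ʳ lower k k+1<n)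
𝟙Des-suc {n} σ k k+1<n with suc k <? n
... | yes _ = refl
... | no k+1≮n = ⊥-elim (k+1≮n k+1<n)

𝟙Des-suc-out : {n : ℕ} (σ : Permutation′ n) (k : ℕ) → ¬ suc k < n → 𝟙Des σ (suc k) ≡ 0
𝟙Des-suc-out {n} σ k k+1≮n with suc k <? n
... | yes k+1<n = ⊥-elim (k+1≮n k+1<n)
... | no _ = refl

∑-allFin-δ-descent : {n : ℕ} (σ : Permutation′ n) (a : Fin n) (K : ℕ) →
  ∑[ b ∈ allFin n ] (𝟙 (toℕ b ≟ suc (toℕ a)) * (𝟙 (σ ⟨$⟩ʳ b Fin.<? σ ⟨$⟩ʳ a) * K)) ≡ 𝟙Des σ (suc (toℕ a)) * K
∑-allFin-δ-descent {n} σ a K = by-range (suc (toℕ a) <? n)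
  where
  by-range : Dec (suc (toℕ a) < n) →
    ∑[ b ∈ allFin n ] (𝟙 (toℕ b ≟ suc (toℕ a)) * (𝟙 (σ ⟨$⟩ʳ b Fin.<? σ ⟨$⟩ʳ a) * K)) ≡ 𝟙Des σ (suc (toℕ a)) * K
  by-range (no a+1≮n) = trans (∑-allFin-δ-out n (suc (toℕ a)) _ a+1≮n) (sym (cong (_* K) (𝟙Des-suc-out σ (toℕ a) a+1≮n)))
  by-range (yes a+1<n) = trans (∑-allFin-δ n (suc (toℕ a)) _ a+1<n) (cong (_* K) (begin
    𝟙 (σ ⟨$⟩ʳ upper (toℕ a) a+1<n Fin.<? σ ⟨$⟩ʳ a)
      ≡⟨ cong (λ x → 𝟙 (σ ⟨$⟩ʳ upper (toℕ a) a+1<n Fin.<? σ ⟨$⟩ʳ x)) (Finₚ.toℕ-injective (toℕ-lower (toℕ a) a+1<n)) ⟨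
    𝟙 (σ ⟨$⟩ʳ upper (toℕ a) a+1<n Fin.<? σ ⟨$⟩ʳ lower (toℕ a) a+1<n)
      ≡⟨ 𝟙Des-suc σ (toℕ a) a+1<n ⟨
    𝟙Des σ (suc (toℕ a)) ∎))
    where open ≡-Reasoning

∑-Des : {n : ℕ} (σ : Permutation′ n) (F : ℕ → ℕ) → ∑ (Des σ) F ≡ ∑[ i ∈ letters n ] (𝟙Des σ i * F i)
∑-Des {n} σ F = begin
  ∑ (Des σ) F
    ≡⟨ ∑-map (filter _ (cartesianProduct (allFin n) (allFin n))) _ F ⟩
  ∑ (filter _ (cartesianProduct (allFin n) (allFin n))) _
    ≡⟨ ∑-filter _ (cartesianProduct (allFin n) (allFin n)) _ ⟩
  ∑ (cartesianProduct (allFin n) (allFin n)) _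
    ≡⟨ ∑-cartesianProduct (allFin n) (allFin n) _ ⟩
  ∑[ a ∈ allFin n ] ∑[ b ∈ allFin n ] (𝟙 ((toℕ b ≟ suc (toℕ a)) ×-dec (σ ⟨$⟩ʳ b Fin.<? σ ⟨$⟩ʳ a)) * F (suc (toℕ a)))
    ≡⟨ ∑-cong (allFin n) (λ a → ∑-cong (allFin n) (λ b →
         trans (cong (_* F (suc (toℕ a))) (𝟙-× (toℕ b ≟ suc (toℕ a)) (σ ⟨$⟩ʳ b Fin.<? σ ⟨$⟩ʳ a)))
           (*-assoc (𝟙 (toℕ b ≟ suc (toℕ a))) (𝟙 (σ ⟨$⟩ʳ b Fin.<? σ ⟨$⟩ʳ a)) (F (suc (toℕ a)))))) ⟩
  ∑[ a ∈ allFin n ] ∑[ b ∈ allFin n ] (𝟙 (toℕ b ≟ suc (toℕ a)) * (𝟙 (σ ⟨$⟩ʳ b Fin.<? σ ⟨$⟩ʳ a) * F (suc (toℕ a))))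
    ≡⟨ ∑-cong (allFin n) (λ a → ∑-allFin-δ-descent σ a (F (suc (toℕ a)))) ⟩
  ∑[ a ∈ allFin n ] φ (toℕ a)
    ≡⟨ ∑-allFin-toℕ n φ ⟩
  ∑ (upTo n) φ
    ≡⟨ drop-last n refl ⟩
  ∑ (upTo (n ∸ 1)) φ
    ≡⟨ ∑-map (upTo (n ∸ 1)) suc _ ⟨
  ∑[ i ∈ letters n ] (𝟙Des σ i * F i) ∎
  where
  open ≡-Reasoning
  φ : ℕ → ℕ
  φ k = 𝟙Des σ (suc k) * F (suc k)

  drop-last : (m : ℕ) → m ≡ n → ∑ (upTo m) φ ≡ ∑ (upTo (m ∸ 1)) φ
  drop-last zero _ = refl
  drop-last (suc m) m+1≡n = begin
    ∑ (upTo (suc m)) φ        ≡⟨ cong (λ xs → ∑ xs φ) (upTo-∷ʳ m) ⟨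
    ∑ (upTo m ∷ʳ m) φ         ≡⟨ ∑-++ (upTo m) (m ∷ []) φ ⟩
    ∑ (upTo m) φ + (φ m + 0)  ≡⟨ cong (λ x → ∑ (upTo m) φ + (x * F (suc m) + 0)) (𝟙Des-suc-out σ m (λ m+1<n → <-irrefl m+1≡n m+1<n)) ⟩
    ∑ (upTo m) φ + 0          ≡⟨ +-identityʳ _ ⟩
    ∑ (upTo m) φ              ∎

∈-letters⁻ : {n j : ℕ} → j ∈ letters n → ∃ λ k → j ≡ suc k × suc k < n
∈-letters⁻ {suc n} j∈ with ∈-map⁻ suc j∈
... | k , k∈ , refl = k , refl , s≤s (∈-upTo⁻ k∈)

ℓ-·s-cases : {n : ℕ} (σ : Permutation′ n) {j : ℕ} → j ∈ letters n →
  (𝟙Des σ j ≡ 1 × suc (ℓ (σ · s j)) ≡ ℓ σ) ⊎ (𝟙Des σ j ≡ 0 × ℓ (σ · s j) ≡ suc (ℓ σ))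
ℓ-·s-cases {n} σ j∈ with ∈-letters⁻ {n} j∈
... | k , refl , k+1<n with σ ⟨$⟩ʳ upper k k+1<n Fin.<? σ ⟨$⟩ʳ lower k k+1<n in eq
...   | yes descent = inj₁ (trans (𝟙Des-suc σ k k+1<n) (cong 𝟙 eq) , ℓ-·s-descent σ k k+1<n descent)
...   | no ascent = inj₂ (trans (𝟙Des-suc σ k k+1<n) (cong 𝟙 eq) , ℓ-·s-ascent σ k k+1<n ascent)

ℓ-·s-≤ : {n : ℕ} (σ : Permutation′ n) (i : ℕ) → ℓ (σ · s i) ≤ suc (ℓ σ)
ℓ-·s-≤ σ zero = n≤1+n _
ℓ-·s-≤ {n} σ (suc k) = by-range (suc k <? n)
  where
  -- Matching on suc k <? n with `with` would also abstract the identical test inside s (suc k).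
  by-range : Dec (suc k < n) → ℓ (σ · s (suc k)) ≤ suc (ℓ σ)
  by-range (no k+1≮n) = ≤-trans (≤-reflexive (ℓ-cong {σ = σ · s (suc k)} {σ} (λ x → cong (σ ⟨$⟩ʳ_) (s-suc-out k k+1≮n x)))) (n≤1+n _)
  by-range (yes k+1<n) with σ ⟨$⟩ʳ upper k k+1<n Fin.<? σ ⟨$⟩ʳ lower k k+1<n
  ... | yes descent = ≤-trans (n≤1+n _) (≤-trans (≤-reflexive (ℓ-·s-descent σ k k+1<n descent)) (n≤1+n _))
  ... | no ascent = ≤-reflexive (ℓ-·s-ascent σ k k+1<n ascent)

ℓ-·prod-≤ : {n : ℕ} (σ : Permutation′ n) (w : List ℕ) → ℓ (σ · prod w) ≤ ℓ σ + length w
ℓ-·prod-≤ σ [] = ≤-reflexive (sym (+-identityʳ _))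
ℓ-·prod-≤ σ (i ∷ w) = begin
  ℓ ((σ · s i) · prod w)       ≤⟨ ℓ-·prod-≤ (σ · s i) w ⟩
  ℓ (σ · s i) + length w       ≤⟨ +-monoˡ-≤ (length w) (ℓ-·s-≤ σ i) ⟩
  suc (ℓ σ) + length w         ≡⟨ +-suc (ℓ σ) (length w) ⟨
  ℓ σ + length (i ∷ w)         ∎
  where open ≤-Reasoning

ℓ-prod-≤ : {n : ℕ} (w : List ℕ) → ℓ (prod {n} w) ≤ length w
ℓ-prod-≤ {n} w = begin
  ℓ (idₚ {n} · prod w)         ≤⟨ ℓ-·prod-≤ (idₚ {n}) w ⟩
  ℓ (idₚ {n}) + length w       ≡⟨ cong (_+ length w) (ℓ-id {n}) ⟩
  length w                     ∎
  where open ≤-Reasoning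

Far : ℕ → ℕ → Set
Far a b = 1 < ∣ a - b ∣

far? : (a b : ℕ) → Dec (Far a b)
far? a b = 1 <? ∣ a - b ∣

Far⇒ : (a b : ℕ) → Far a b → suc a < b ⊎ suc b < a
Far⇒ zero (suc b) far = inj₁ far
Far⇒ (suc a) zero far = inj₂ far
Far⇒ (suc a) (suc b) far with Far⇒ a b far
... | inj₁ a+1<b = inj₁ (s≤s a+1<b)
... | inj₂ b+1<a = inj₂ (s≤s b+1<a)

⇒Far : (a b : ℕ) → suc a < b ⊎ suc b < a → Far a b
⇒Far zero (suc b) (inj₁ a+1<b) = a+1<b
⇒Far (suc a) zero (inj₂ b+1<a) = b+1<a
⇒Far (suc a) (suc b) (inj₁ (s≤s a+1<b)) = ⇒Far a b (inj₁ a+1<b)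
⇒Far (suc a) (suc b) (inj₂ (s≤s b+1<a)) = ⇒Far a b (inj₂ b+1<a)

Far-sym : (a b : ℕ) → Far a b → Far b a
Far-sym a b = subst (1 <_) (∣-∣-comm a b)

𝟙-far : (a b : ℕ) → 𝟙 (far? a b) ≡ 𝟙 (suc a <? b) + 𝟙 (suc b <? a)
𝟙-far a b with far? a b | suc a <? b | suc b <? a
... | _ | yes a+1<b | yes b+1<a = ⊥-elim (<-asym (<-trans (n<1+n a) a+1<b) (<-trans (n<1+n b) b+1<a))
... | yes _ | yes _ | no _ = refl
... | yes _ | no _ | yes _ = refl
... | yes far | no a+1≮b | no b+1≮a = ⊥-elim ([ a+1≮b , b+1≮a ] (Far⇒ a b far))
... | no ¬far | yes a+1<b | no _ = ⊥-elim (¬far (⇒Far a b (inj₁ a+1<b)))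
... | no ¬far | no _ | yes b+1<a = ⊥-elim (¬far (⇒Far a b (inj₂ b+1<a)))
... | no _ | no _ | no _ = refl

InSupport : {n : ℕ} → ℕ → Fin n → Set
InSupport i x = toℕ x ≡ i ⊎ suc (toℕ x) ≡ i

inSupport? : {n : ℕ} (i : ℕ) (x : Fin n) → Dec (InSupport i x)
inSupport? i x = (toℕ x ≟ i) ⊎-dec (suc (toℕ x) ≟ i)

s-fixes : {n : ℕ} (i : ℕ) (x : Fin n) → ¬ InSupport i x → s {n} i ⟨$⟩ʳ x ≡ x
s-fixes zero x _ = refl
s-fixes {n} (suc k) x x∉supp = by-range (suc k <? n)
  where
  by-range : Dec (suc k < n) → s {n} (suc k) ⟨$⟩ʳ x ≡ x
  by-range (no k+1≮n) = s-suc-out k k+1≮n x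
  by-range (yes k+1<n) = trans (s-suc k k+1<n x) (transpose-mismatch _ _ x
    (λ x≡lo → x∉supp (inj₂ (cong suc (trans (cong toℕ x≡lo) (toℕ-lower k k+1<n)))))
    (λ x≡hi → x∉supp (inj₁ (trans (cong toℕ x≡hi) (toℕ-upper k k+1<n)))))

s-preserves-support : {n : ℕ} (i : ℕ) (x : Fin n) → InSupport i x → InSupport i (s {n} i ⟨$⟩ʳ x)
s-preserves-support zero x x∈supp = x∈supp
s-preserves-support {n} (suc k) x x∈supp = by-range (suc k <? n) x∈supp
  where
  by-range : Dec (suc k < n) → InSupport (suc k) x → InSupport (suc k) (s {n} (suc k) ⟨$⟩ʳ x)
  by-range (no k+1≮n) _ = subst (InSupport (suc k)) (sym (s-suc-out k k+1≮n x)) x∈supp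
  by-range (yes k+1<n) (inj₁ x≡k+1) = inj₂ (cong suc (begin
    toℕ (s (suc k) ⟨$⟩ʳ x)       ≡⟨ toℕ-s-suc k k+1<n x ⟩
    swap k (toℕ x)               ≡⟨ cong (swap k) x≡k+1 ⟩
    swap k (suc k)               ≡⟨ swap-suc-k k ⟩
    k                            ∎))
    where open ≡-Reasoning
  by-range (yes k+1<n) (inj₂ x+1≡k+1) = inj₁ (begin
    toℕ (s (suc k) ⟨$⟩ʳ x)       ≡⟨ toℕ-s-suc k k+1<n x ⟩
    swap k (toℕ x)               ≡⟨ cong (swap k) (suc-injective x+1≡k+1) ⟩
    swap k k                     ≡⟨ swap-k k ⟩
    suc k                        ∎)
    where open ≡-Reasoning

far-supports-disjoint : {n : ℕ} (a b : ℕ) (x : Fin n) → Far a b → InSupport a x → InSupport b x → ⊥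
far-supports-disjoint a b x far x∈a x∈b with Far⇒ a b far | bounds x∈a | bounds x∈b
  where
  bounds : {i : ℕ} → InSupport i x → toℕ x ≤ i × i ≤ suc (toℕ x)
  bounds (inj₁ refl) = ≤-refl , n≤1+n _
  bounds (inj₂ refl) = n≤1+n _ , ≤-refl
... | inj₁ a+1<b | x≤a , _ | _ , b≤x+1 = <-irrefl refl (≤-trans a+1<b (≤-trans b≤x+1 (s≤s x≤a)))
... | inj₂ b+1<a | _ , a≤x+1 | x≤b , _ = <-irrefl refl (≤-trans b+1<a (≤-trans a≤x+1 (s≤s x≤b)))

s-comm : {n : ℕ} (a b : ℕ) → Far a b → s {n} a · s b ≈ s b · s a
s-comm a b far z with inSupport? a z
... | yes z∈a = trans (cong (s a ⟨$⟩ʳ_) (s-fixes b z (far-supports-disjoint a b z far z∈a)))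
                      (sym (s-fixes b _ (far-supports-disjoint a b _ far (s-preserves-support a z z∈a))))
... | no z∉a with inSupport? b z
...   | yes z∈b = trans (s-fixes a _ (λ sz∈a → far-supports-disjoint a b _ far sz∈a (s-preserves-support b z z∈b)))
                        (cong (s b ⟨$⟩ʳ_) (sym (s-fixes a z z∉a)))
...   | no z∉b = begin
  s a ⟨$⟩ʳ (s b ⟨$⟩ʳ z)    ≡⟨ cong (s a ⟨$⟩ʳ_) (s-fixes b z z∉b) ⟩
  s a ⟨$⟩ʳ z               ≡⟨ s-fixes a z z∉a ⟩
  z                        ≡⟨ s-fixes b z z∉b ⟨
  s b ⟨$⟩ʳ z               ≡⟨ cong (s b ⟨$⟩ʳ_) (s-fixes a z z∉a) ⟨
  s b ⟨$⟩ʳ (s a ⟨$⟩ʳ z)    ∎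
  where open ≡-Reasoning

𝟙Des-far : {n : ℕ} (σ : Permutation′ n) (i j : ℕ) → Far i j → 𝟙Des (σ · s i) j ≡ 𝟙Des σ j
𝟙Des-far σ i zero far = refl
𝟙Des-far {n} σ i (suc k) far = by-range (suc k <? n)
  where
  by-range : Dec (suc k < n) → 𝟙Des (σ · s i) (suc k) ≡ 𝟙Des σ (suc k)
  by-range (no k+1≮n) = trans (𝟙Des-suc-out (σ · s i) k k+1≮n) (sym (𝟙Des-suc-out σ k k+1≮n))
  by-range (yes k+1<n) = begin
    𝟙Des (σ · s i) (suc k)
      ≡⟨ 𝟙Des-suc (σ · s i) k k+1<n ⟩
    𝟙 (σ ⟨$⟩ʳ (s i ⟨$⟩ʳ hi) Fin.<? σ ⟨$⟩ʳ (s i ⟨$⟩ʳ lo))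
      ≡⟨ cong₂ (λ u v → 𝟙 (σ ⟨$⟩ʳ u Fin.<? σ ⟨$⟩ʳ v))
           (s-fixes i hi (λ hi∈i → far-supports-disjoint i (suc k) hi far hi∈i (inj₁ (toℕ-upper k k+1<n))))
           (s-fixes i lo (λ lo∈i → far-supports-disjoint i (suc k) lo far lo∈i (inj₂ (cong suc (toℕ-lower k k+1<n))))) ⟩
    𝟙 (σ ⟨$⟩ʳ hi Fin.<? σ ⟨$⟩ʳ lo)
      ≡⟨ 𝟙Des-suc σ k k+1<n ⟨
    𝟙Des σ (suc k) ∎
    where
    open ≡-Reasoning
    lo = lower k k+1<n
    hi = upper k k+1<n

letters-unique : (n : ℕ) → Unique (letters n)
letters-unique n = Uniqueₚ.map⁺ suc-injective (Uniqueₚ.upTo⁺ (n ∸ 1))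

∈-words⁻ : {n l : ℕ} {w : List ℕ} → w ∈ words n (suc l) → ∃ λ i → ∃ λ u → i ∈ letters n × u ∈ words n l × w ≡ i ∷ u
∈-words⁻ {n} {l} w∈ with find (∈-concatMap⁻ (λ i → map (i ∷_) (words n l)) {xs = letters n} w∈)
... | i , i∈ , w∈i∷ with ∈-map⁻ (i ∷_) w∈i∷
...   | u , u∈ , refl = i , u , i∈ , u∈ , refl

words-length : (n l : ℕ) {w : List ℕ} → w ∈ words n l → length w ≡ l
words-length n zero (here refl) = refl
words-length n (suc l) w∈ with ∈-words⁻ {n} {l} w∈
... | _ , _ , _ , u∈ , refl = cong suc (words-length n l u∈)

words-letters : (n l : ℕ) {w : List ℕ} → w ∈ words n l → All (_∈ letters n) w
words-letters n zero (here refl) = []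
words-letters n (suc l) w∈ with ∈-words⁻ {n} {l} w∈
... | _ , _ , i∈ , u∈ , refl = i∈ ∷ words-letters n l u∈

∑-words-∷ʳ : (n l : ℕ) (g : List ℕ → ℕ) →
  ∑ (words n (suc l)) g ≡ ∑[ j ∈ letters n ] ∑[ u ∈ words n l ] g (u ∷ʳ j)
∑-words-∷ʳ n zero g = ∑-concatMap (letters n) (λ i → map (i ∷_) (words n zero)) g
∑-words-∷ʳ n (suc l) g = begin
  ∑ (words n (suc (suc l))) g
    ≡⟨ ∑-concatMap (letters n) _ g ⟩
  ∑[ i ∈ letters n ] ∑ (map (i ∷_) (words n (suc l))) g
    ≡⟨ ∑-cong (letters n) (λ i → ∑-map (words n (suc l)) (i ∷_) g) ⟩
  ∑[ i ∈ letters n ] ∑[ w ∈ words n (suc l) ] g (i ∷ w)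
    ≡⟨ ∑-cong (letters n) (λ i → ∑-words-∷ʳ n l (λ w → g (i ∷ w))) ⟩
  ∑[ i ∈ letters n ] ∑[ j ∈ letters n ] ∑[ u ∈ words n l ] g (i ∷ u ∷ʳ j)
    ≡⟨ ∑-comm (letters n) (letters n) _ ⟩
  ∑[ j ∈ letters n ] ∑[ i ∈ letters n ] ∑[ u ∈ words n l ] g (i ∷ u ∷ʳ j)
    ≡⟨ ∑-cong (letters n) (λ j → sym (trans (∑-concatMap (letters n) (λ i → map (i ∷_) (words n l)) _)
         (∑-cong (letters n) (λ i → ∑-map (words n l) (i ∷_) _)))) ⟩
  ∑[ j ∈ letters n ] ∑[ u ∈ words n (suc l) ] g (u ∷ʳ j) ∎
  where open ≡-Reasoning

∑-words-δ : (n l : ℕ) {y : List ℕ} → length y ≡ l → All (_∈ letters n) y → (f : List ℕ → ℕ) →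
  ∑[ u ∈ words n l ] (𝟙 (≡-dec _≟_ u y) * f u) ≡ f y
∑-words-δ n zero {[]} _ _ f = trans (+-identityʳ _) (*-identityˡ (f []))
∑-words-δ n (suc l) {a ∷ y} |y|+1≡l+1 (a∈ ∷ y∈) f = begin
  ∑[ u ∈ words n (suc l) ] (𝟙 (≡-dec _≟_ u (a ∷ y)) * f u)
    ≡⟨ ∑-concatMap (letters n) (λ i → map (i ∷_) (words n l)) _ ⟩
  ∑[ i ∈ letters n ] ∑ (map (i ∷_) (words n l)) (λ u → 𝟙 (≡-dec _≟_ u (a ∷ y)) * f u)
    ≡⟨ ∑-cong (letters n) (λ i → ∑-map (words n l) (i ∷_) _) ⟩
  ∑[ i ∈ letters n ] ∑[ u ∈ words n l ] (𝟙 (≡-dec _≟_ (i ∷ u) (a ∷ y)) * f (i ∷ u))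
    ≡⟨ ∑-cong (letters n) (λ i → ∑-cong (words n l) (λ u → trans (cong (_* f (i ∷ u)) (𝟙-≟-∷ i a u y))
         (*-assoc (𝟙 (i ≟ a)) _ _))) ⟩
  ∑[ i ∈ letters n ] ∑[ u ∈ words n l ] (𝟙 (i ≟ a) * (𝟙 (≡-dec _≟_ u y) * f (i ∷ u)))
    ≡⟨ ∑-cong (letters n) (λ i → trans (∑-*ˡ (words n l) (𝟙 (i ≟ a)) _)
         (cong (𝟙 (i ≟ a) *_) (∑-words-δ n l (suc-injective |y|+1≡l+1) y∈ (λ u → f (i ∷ u))))) ⟩
  ∑[ i ∈ letters n ] (𝟙 (i ≟ a) * f (i ∷ y))
    ≡⟨ ∑-δ _≟_ (letters-unique n) a∈ (λ i → f (i ∷ y)) ⟩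
  f (a ∷ y) ∎
  where
  open ≡-Reasoning
  𝟙-≟-∷ : (i a : ℕ) (u y : List ℕ) → 𝟙 (≡-dec _≟_ (i ∷ u) (a ∷ y)) ≡ 𝟙 (i ≟ a) * 𝟙 (≡-dec _≟_ u y)
  𝟙-≟-∷ i a u y = trans (𝟙-cong (≡-dec _≟_ (i ∷ u) (a ∷ y)) ((i ≟ a) ×-dec (≡-dec _≟_ u y))
    ∷-injective (λ { (refl , refl) → refl })) (𝟙-× (i ≟ a) (≡-dec _≟_ u y))

-- Commutation moves

𝟙FarLast : List ℕ → ℕ → ℕ
𝟙FarLast [] i = 0
𝟙FarLast (x ∷ []) i = 𝟙 (far? x i)
𝟙FarLast (x ∷ y ∷ w) i = 𝟙FarLast (y ∷ w) i

𝟙FarLast-∷ʳ : (u : List ℕ) (j i : ℕ) → 𝟙FarLast (u ∷ʳ j) i ≡ 𝟙 (far? j i)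
𝟙FarLast-∷ʳ [] j i = refl
𝟙FarLast-∷ʳ (a ∷ []) j i = refl
𝟙FarLast-∷ʳ (a ∷ b ∷ u) j i = 𝟙FarLast-∷ʳ (b ∷ u) j i

length-commMoves-∷∷ : (a b : ℕ) (w : List ℕ) → length (commMoves (a ∷ b ∷ w)) ≡ 𝟙 (far? a b) + length (commMoves (b ∷ w))
length-commMoves-∷∷ a b w with far? a b
... | yes _ = cong suc (length-map (a ∷_) (commMoves (b ∷ w)))
... | no _ = length-map (a ∷_) (commMoves (b ∷ w))

length-commMoves-∷ʳ : (u : List ℕ) (i : ℕ) → length (commMoves (u ∷ʳ i)) ≡ length (commMoves u) + 𝟙FarLast u i
length-commMoves-∷ʳ [] i = refl
length-commMoves-∷ʳ (a ∷ []) i = trans (length-commMoves-∷∷ a i []) (+-identityʳ _)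
length-commMoves-∷ʳ (a ∷ b ∷ w) i = begin
  length (commMoves (a ∷ b ∷ w ∷ʳ i))                         ≡⟨ length-commMoves-∷∷ a b (w ∷ʳ i) ⟩
  𝟙 (far? a b) + length (commMoves (b ∷ w ∷ʳ i))              ≡⟨ cong (𝟙 (far? a b) +_) (length-commMoves-∷ʳ (b ∷ w) i) ⟩
  𝟙 (far? a b) + (length (commMoves (b ∷ w)) + 𝟙FarLast (b ∷ w) i) ≡⟨ +-assoc (𝟙 (far? a b)) _ _ ⟨
  𝟙 (far? a b) + length (commMoves (b ∷ w)) + 𝟙FarLast (b ∷ w) i   ≡⟨ cong (_+ 𝟙FarLast (b ∷ w) i) (length-commMoves-∷∷ a b w) ⟨
  length (commMoves (a ∷ b ∷ w)) + 𝟙FarLast (a ∷ b ∷ w) i     ∎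
  where open ≡-Reasoning

∈-commMoves⁻ : {a b : ℕ} {w u : List ℕ} → u ∈ commMoves (a ∷ b ∷ w) →
  (Far a b × u ≡ b ∷ a ∷ w) ⊎ (∃ λ u′ → u′ ∈ commMoves (b ∷ w) × u ≡ a ∷ u′)
∈-commMoves⁻ {a} {b} u∈ with far? a b
∈-commMoves⁻ (here refl) | yes far = inj₁ (far , refl)
∈-commMoves⁻ {a} (there u∈) | yes _ = inj₂ (∈-map⁻ (a ∷_) u∈)
∈-commMoves⁻ {a} u∈ | no _ = inj₂ (∈-map⁻ (a ∷_) u∈)

commMoves-length : (v : List ℕ) {u : List ℕ} → u ∈ commMoves v → length u ≡ length v
commMoves-length (a ∷ b ∷ w) u∈ with ∈-commMoves⁻ {a} {b} {w} u∈
... | inj₁ (_ , refl) = refl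
... | inj₂ (u′ , u′∈ , refl) = cong suc (commMoves-length (b ∷ w) u′∈)

commMoves-All : {P : ℕ → Set p} (v : List ℕ) {u : List ℕ} → u ∈ commMoves v → All P v → All P u
commMoves-All (a ∷ b ∷ w) u∈ (pa ∷ pb ∷ pw) with ∈-commMoves⁻ {a} {b} {w} u∈
... | inj₁ (_ , refl) = pb ∷ pa ∷ pw
... | inj₂ (u′ , u′∈ , refl) = pa ∷ commMoves-All (b ∷ w) u′∈ (pb ∷ pw)

prod-commMoves : {n : ℕ} (v : List ℕ) {u : List ℕ} → u ∈ commMoves v → prod {n} u ≈ prod v
prod-commMoves (a ∷ b ∷ w) u∈ x with ∈-commMoves⁻ {a} {b} {w} u∈
... | inj₁ (far , refl) = sym (s-comm a b far (prod w ⟨$⟩ʳ x))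
... | inj₂ (u′ , u′∈ , refl) = cong (s a ⟨$⟩ʳ_) (prod-commMoves (b ∷ w) u′∈ x)

commMoves-unique : (v : List ℕ) → Unique (commMoves v)
commMoves-unique [] = []
commMoves-unique (a ∷ []) = []
commMoves-unique (a ∷ b ∷ w) with far? a b | Uniqueₚ.map⁺ ∷-injectiveʳ (commMoves-unique (b ∷ w))
... | yes far | moves-after-a-unique = All.tabulate ba∷w≢ ∷ moves-after-a-unique
  where
  ba∷w≢ : {u : List ℕ} → u ∈ map (a ∷_) (commMoves (b ∷ w)) → b ∷ a ∷ w ≢ u
  ba∷w≢ u∈ with ∈-map⁻ (a ∷_) u∈
  ... | _ , _ , refl = λ { refl → n≮0 (subst (1 <_) (∣n-n∣≡0 a) far) }
... | no _ | moves-after-a-unique = moves-after-a-unique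

_≟ₗ_ : DecidableEquality (List ℕ)
_≟ₗ_ = ≡-dec _≟_

∈-𝓡⁻ : {n : ℕ} (σ : Permutation′ n) {v : List ℕ} → v ∈ 𝓡 σ → v ∈ words n (ℓ σ) × prod v ≈ σ
∈-𝓡⁻ σ {v} v∈ with ∈-filter⁻ (λ w → prod w ≟ₚ σ) v∈
... | v∈words , eqs = v∈words , ≈-fromAll {σ = prod v} {σ} eqs

-- The commutation moves of a reduced word of σ are distinct reduced words of σ.
d𝓒≡length-commMoves : {n : ℕ} (σ : Permutation′ n) {v : List ℕ} → v ∈ 𝓡 σ → d𝓒 σ v ≡ length (commMoves v)
d𝓒≡length-commMoves {n} σ {v} v∈ = begin
  d𝓒 σ v
    ≡⟨ length-filter≡∑𝟙 (_∈ₗ? commMoves v) (𝓡 σ) ⟩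
  ∑[ u ∈ 𝓡 σ ] 𝟙 (u ∈ₗ? commMoves v)
    ≡⟨ ∑-filter (λ w → prod w ≟ₚ σ) W _ ⟩
  ∑[ u ∈ W ] (𝟙 (prod u ≟ₚ σ) * 𝟙 (u ∈ₗ? commMoves v))
    ≡⟨ ∑-cong W (λ u → trans (cong (𝟙 (prod u ≟ₚ σ) *_) (𝟙-∈?≡∑𝟙-≟ _≟ₗ_ (commMoves-unique v) u))
         (trans (sym (∑-*ˡ (commMoves v) (𝟙 (prod u ≟ₚ σ)) _)) (∑-cong (commMoves v) (λ y → *-comm (𝟙 (prod u ≟ₚ σ)) _)))) ⟩
  ∑[ u ∈ W ] ∑[ y ∈ commMoves v ] (𝟙 (u ≟ₗ y) * 𝟙 (prod u ≟ₚ σ))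
    ≡⟨ ∑-comm W (commMoves v) _ ⟩
  ∑[ y ∈ commMoves v ] ∑[ u ∈ W ] (𝟙 (u ≟ₗ y) * 𝟙 (prod u ≟ₚ σ))
    ≡⟨ ∑-cong-∈ (commMoves v) (λ y y∈ → ∑-words-δ n (ℓ σ) (trans (commMoves-length v y∈) (words-length n (ℓ σ) v∈W))
         (commMoves-All v y∈ (words-letters n (ℓ σ) v∈W)) (λ u → 𝟙 (prod u ≟ₚ σ))) ⟩
  ∑[ y ∈ commMoves v ] 𝟙 (prod y ≟ₚ σ)
    ≡⟨ ∑-cong-∈ (commMoves v) (λ y y∈ → 𝟙-≟ₚ-yes {σ = prod y} {σ} (λ x → trans (prod-commMoves v y∈ x) (v≈σ x))) ⟩
  ∑[ y ∈ commMoves v ] 1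
    ≡⟨ length≡∑1 (commMoves v) ⟨
  length (commMoves v) ∎
  where
  open ≡-Reasoning
  W = words n (ℓ σ)
  v∈W = proj₁ (∈-𝓡⁻ σ v∈)
  v≈σ = proj₂ (∈-𝓡⁻ σ v∈)

-- Reduced words by their last letter

∑-𝓡 : {n : ℕ} (τ : Permutation′ n) (g : List ℕ → ℕ) → ∑ (𝓡 τ) g ≡ ∑[ w ∈ words n (ℓ τ) ] (𝟙 (prod w ≟ₚ τ) * g w)
∑-𝓡 {n} τ g = ∑-filter (λ w → prod w ≟ₚ τ) (words n (ℓ τ)) g

∑-words-·s : {n : ℕ} (τ : Permutation′ n) (l : ℕ) → ℓ τ ≡ suc l → {j : ℕ} → j ∈ letters n → (h : List ℕ → ℕ) →
  ∑[ u ∈ words n l ] (𝟙 (prod u ≟ₚ (τ · s j)) * h u) ≡ 𝟙Des τ j * ∑ (𝓡 (τ · s j)) h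
∑-words-·s {n} τ l ℓτ≡l+1 {j} j∈ h with ℓ-·s-cases τ j∈
... | inj₁ (descent , ℓτsⱼ+1≡ℓτ) = begin
  ∑[ u ∈ words n l ] (𝟙 (prod u ≟ₚ (τ · s j)) * h u)
    ≡⟨ cong (λ m → ∑[ u ∈ words n m ] (𝟙 (prod u ≟ₚ (τ · s j)) * h u)) (suc-injective (trans ℓτsⱼ+1≡ℓτ ℓτ≡l+1)) ⟨
  ∑[ u ∈ words n (ℓ (τ · s j)) ] (𝟙 (prod u ≟ₚ (τ · s j)) * h u)
    ≡⟨ ∑-𝓡 (τ · s j) h ⟨
  ∑ (𝓡 (τ · s j)) h
    ≡⟨ *-identityˡ _ ⟨
  1 * ∑ (𝓡 (τ · s j)) h
    ≡⟨ cong (_* ∑ (𝓡 (τ · s j)) h) descent ⟨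
  𝟙Des τ j * ∑ (𝓡 (τ · s j)) h ∎
  where open ≡-Reasoning
... | inj₂ (ascent , ℓτsⱼ≡ℓτ+1) =
  trans (∑-≡0 (words n l) _ (λ u u∈ → cong (_* h u) (𝟙-no (prod u ≟ₚ (τ · s j)) (too-short u u∈))))
        (sym (cong (_* ∑ (𝓡 (τ · s j)) h) ascent))
  where
  too-short : (u : List ℕ) → u ∈ words n l → ¬ All (λ x → prod u ⟨$⟩ʳ x ≡ (τ · s j) ⟨$⟩ʳ x) (allFin n)
  too-short u u∈ eqs = 1+n≰n (≤-trans (n≤1+n (suc l)) (begin
    suc (suc l)            ≡⟨ trans ℓτsⱼ≡ℓτ+1 (cong suc ℓτ≡l+1) ⟨
    ℓ (τ · s j)            ≡⟨ ℓ-cong {σ = prod u} {τ · s j} (≈-fromAll {σ = prod u} {τ · s j} eqs) ⟨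
    ℓ (prod {n} u)         ≤⟨ ℓ-prod-≤ {n} u ⟩
    length u               ≡⟨ words-length n l u∈ ⟩
    l                      ∎))
    where open ≤-Reasoning

-- g [] ≡ 0 accounts for τ = id, whose only reduced word is the empty one.
∑-𝓡-∷ʳ : {n : ℕ} (τ : Permutation′ n) (g : List ℕ → ℕ) → g [] ≡ 0 →
  ∑ (𝓡 τ) g ≡ ∑[ j ∈ letters n ] (𝟙Des τ j * ∑[ u ∈ 𝓡 (τ · s j) ] g (u ∷ʳ j))
∑-𝓡-∷ʳ {n} τ g g[]≡0 = trans (∑-𝓡 τ g) (by-length (ℓ τ) refl)
  where
  RHS = ∑[ j ∈ letters n ] (𝟙Des τ j * ∑[ u ∈ 𝓡 (τ · s j) ] g (u ∷ʳ j))

  by-length : (l : ℕ) → ℓ τ ≡ l → ∑[ w ∈ words n l ] (𝟙 (prod w ≟ₚ τ) * g w) ≡ RHS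
  by-length zero ℓτ≡0 = trans (cong (λ x → 𝟙 (prod [] ≟ₚ τ) * x + 0) g[]≡0)
    (trans (cong (_+ 0) (*-zeroʳ (𝟙 (prod [] ≟ₚ τ)))) (sym (∑-≡0 (letters n) _ no-letter)))
    where
    no-letter : ∀ j → j ∈ letters n → 𝟙Des τ j * ∑[ u ∈ 𝓡 (τ · s j) ] g (u ∷ʳ j) ≡ 0
    no-letter j j∈ with ℓ-·s-cases τ j∈
    ... | inj₁ (_ , ℓτsⱼ+1≡ℓτ) = ⊥-elim (0≢1+n (trans (sym ℓτ≡0) (sym ℓτsⱼ+1≡ℓτ)))
    ... | inj₂ (ascent , _) = cong (_* ∑[ u ∈ 𝓡 (τ · s j) ] g (u ∷ʳ j)) ascent
  by-length (suc l) ℓτ≡l+1 = begin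
    ∑[ w ∈ words n (suc l) ] (𝟙 (prod w ≟ₚ τ) * g w)
      ≡⟨ ∑-words-∷ʳ n l _ ⟩
    ∑[ j ∈ letters n ] ∑[ u ∈ words n l ] (𝟙 (prod (u ∷ʳ j) ≟ₚ τ) * g (u ∷ʳ j))
      ≡⟨ ∑-cong-∈ (letters n) (λ j j∈ → trans (∑-cong (words n l) (λ u → cong (_* g (u ∷ʳ j)) (𝟙-prod-∷ʳ u j τ)))
           (∑-words-·s τ l ℓτ≡l+1 j∈ (λ u → g (u ∷ʳ j)))) ⟩
    RHS ∎
    where open ≡-Reasoning

length-𝓡-cong : {n : ℕ} {σ τ : Permutation′ n} → σ ≈ τ → length (𝓡 σ) ≡ length (𝓡 τ)
length-𝓡-cong {n} {σ} {τ} σ≈τ = begin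
  length (𝓡 σ)                                         ≡⟨ length-filter≡∑𝟙 (λ w → prod w ≟ₚ σ) (words n (ℓ σ)) ⟩
  ∑[ w ∈ words n (ℓ σ) ] 𝟙 (prod w ≟ₚ σ)               ≡⟨ cong (λ l → ∑[ w ∈ words n l ] 𝟙 (prod w ≟ₚ σ)) (ℓ-cong {σ = σ} {τ} σ≈τ) ⟩
  ∑[ w ∈ words n (ℓ τ) ] 𝟙 (prod w ≟ₚ σ)               ≡⟨ ∑-cong (words n (ℓ τ)) (λ w → 𝟙-≟ₚ-cong {σ = prod w} {prod w} {σ} {τ} (λ _ → refl) σ≈τ) ⟩
  ∑[ w ∈ words n (ℓ τ) ] 𝟙 (prod w ≟ₚ τ)               ≡⟨ length-filter≡∑𝟙 (λ w → prod w ≟ₚ τ) (words n (ℓ τ)) ⟨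
  length (𝓡 τ)                                         ∎
  where open ≡-Reasoning

totalComm≡∑-length-commMoves : {n : ℕ} (τ : Permutation′ n) → totalComm τ ≡ ∑[ v ∈ 𝓡 τ ] length (commMoves v)
totalComm≡∑-length-commMoves τ = ∑-cong-∈ (𝓡 τ) (λ v v∈ → d𝓒≡length-commMoves τ v∈)

∑-𝓡-𝟙FarLast : {n : ℕ} (σ : Permutation′ n) (i : ℕ) →
  ∑[ u ∈ 𝓡 (σ · s i) ] 𝟙FarLast u i ≡ ∑[ j ∈ letters n ] (𝟙Des σ j * (𝟙 (far? j i) * length (𝓡 (σ · s j · s i))))
∑-𝓡-𝟙FarLast {n} σ i = begin
  ∑[ u ∈ 𝓡 (σ · s i) ] 𝟙FarLast u i
    ≡⟨ ∑-𝓡-∷ʳ (σ · s i) (λ u → 𝟙FarLast u i) refl ⟩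
  ∑[ j ∈ letters n ] (𝟙Des (σ · s i) j * ∑[ u ∈ 𝓡 (σ · s i · s j) ] 𝟙FarLast (u ∷ʳ j) i)
    ≡⟨ ∑-cong (letters n) (λ j → cong (𝟙Des (σ · s i) j *_)
         (trans (∑-cong (𝓡 (σ · s i · s j)) (λ u → 𝟙FarLast-∷ʳ u j i)) (∑-const (𝓡 (σ · s i · s j)) _))) ⟩
  ∑[ j ∈ letters n ] (𝟙Des (σ · s i) j * (length (𝓡 (σ · s i · s j)) * 𝟙 (far? j i)))
    ≡⟨ ∑-cong (letters n) (λ j → far-only j (far? j i)) ⟩
  ∑[ j ∈ letters n ] (𝟙Des σ j * (𝟙 (far? j i) * length (𝓡 (σ · s j · s i)))) ∎
  where
  open ≡-Reasoning
  far-only : (j : ℕ) (far?ji : Dec (Far j i)) →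
    𝟙Des (σ · s i) j * (length (𝓡 (σ · s i · s j)) * 𝟙 far?ji) ≡ 𝟙Des σ j * (𝟙 far?ji * length (𝓡 (σ · s j · s i)))
  far-only j (no _) = trans (cong (𝟙Des (σ · s i) j *_) (*-zeroʳ (length (𝓡 (σ · s i · s j)))))
    (trans (*-zeroʳ (𝟙Des (σ · s i) j)) (sym (*-zeroʳ (𝟙Des σ j))))
  far-only j (yes far) = cong₂ _*_ (𝟙Des-far σ i j (Far-sym j i far)) (trans (*-identityʳ _) (trans
    (length-𝓡-cong {σ = σ · s i · s j} {σ · s j · s i} (λ x → cong (σ ⟨$⟩ʳ_) (s-comm i j (Far-sym j i far) x)))
    (sym (+-identityʳ _))))

totalComm-∷ʳ : {n : ℕ} (σ : Permutation′ n) → totalComm σ ≡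
  ∑[ i ∈ letters n ] (𝟙Des σ i * (totalComm (σ · s i)
    + ∑[ j ∈ letters n ] (𝟙Des σ j * (𝟙 (far? j i) * length (𝓡 (σ · s j · s i))))))
totalComm-∷ʳ {n} σ = begin
  totalComm σ
    ≡⟨ totalComm≡∑-length-commMoves σ ⟩
  ∑[ v ∈ 𝓡 σ ] length (commMoves v)
    ≡⟨ ∑-𝓡-∷ʳ σ (length ∘ commMoves) refl ⟩
  ∑[ i ∈ letters n ] (𝟙Des σ i * ∑[ u ∈ 𝓡 (σ · s i) ] length (commMoves (u ∷ʳ i)))
    ≡⟨ ∑-cong (letters n) (λ i → cong (𝟙Des σ i *_) (begin
         ∑[ u ∈ 𝓡 (σ · s i) ] length (commMoves (u ∷ʳ i))
           ≡⟨ ∑-cong (𝓡 (σ · s i)) (λ u → length-commMoves-∷ʳ u i) ⟩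
         ∑[ u ∈ 𝓡 (σ · s i) ] (length (commMoves u) + 𝟙FarLast u i)
           ≡⟨ ∑-distrib-+ (𝓡 (σ · s i)) _ _ ⟩
         ∑[ u ∈ 𝓡 (σ · s i) ] length (commMoves u) + ∑[ u ∈ 𝓡 (σ · s i) ] 𝟙FarLast u i
           ≡⟨ cong₂ _+_ (totalComm≡∑-length-commMoves (σ · s i)) (sym (∑-𝓡-𝟙FarLast σ i)) ⟨
         totalComm (σ · s i) + ∑[ j ∈ letters n ] (𝟙Des σ j * (𝟙 (far? j i) * length (𝓡 (σ · s j · s i)))) ∎)) ⟩
  ∑[ i ∈ letters n ] (𝟙Des σ i * (totalComm (σ · s i)
    + ∑[ j ∈ letters n ] (𝟙Des σ j * (𝟙 (far? j i) * length (𝓡 (σ · s j · s i)))))) ∎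
  where open ≡-Reasoning

∑∑-far≡2*∑∑-below : (xs : List ℕ) (w : ℕ → ℕ → ℕ) → (∀ i j → Far i j → w i j ≡ w j i) →
  ∑[ i ∈ xs ] ∑[ j ∈ xs ] (𝟙 (far? j i) * w i j) ≡ 2 * ∑[ i ∈ xs ] ∑[ j ∈ xs ] (𝟙 (suc j <? i) * w i j)
∑∑-far≡2*∑∑-below xs w w-sym = begin
  ∑[ i ∈ xs ] ∑[ j ∈ xs ] (𝟙 (far? j i) * w i j)
    ≡⟨ ∑-cong xs (λ i → ∑-cong xs (λ j → trans (cong (_* w i j) (𝟙-far j i)) (*-distribʳ-+ (w i j) (𝟙 (suc j <? i)) (𝟙 (suc i <? j))))) ⟩
  ∑[ i ∈ xs ] ∑[ j ∈ xs ] (𝟙 (suc j <? i) * w i j + 𝟙 (suc i <? j) * w i j)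
    ≡⟨ ∑∑-distrib-+ xs xs _ _ ⟩
  below + ∑[ i ∈ xs ] ∑[ j ∈ xs ] (𝟙 (suc i <? j) * w i j)
    ≡⟨ cong (below +_) (∑-comm xs xs _) ⟩
  below + ∑[ j ∈ xs ] ∑[ i ∈ xs ] (𝟙 (suc i <? j) * w i j)
    ≡⟨ cong (below +_) (∑-cong xs (λ j → ∑-cong xs (λ i → symmetric i j (suc i <? j)))) ⟩
  below + below
    ≡⟨ cong (below +_) (+-identityʳ below) ⟨
  2 * below ∎
  where
  open ≡-Reasoning
  below = ∑[ i ∈ xs ] ∑[ j ∈ xs ] (𝟙 (suc j <? i) * w i j)
  symmetric : (i j : ℕ) (i+1<?j : Dec (suc i < j)) → 𝟙 i+1<?j * w i j ≡ 𝟙 i+1<?j * w j i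
  symmetric i j (yes i+1<j) = cong (1 *_) (w-sym i j (⇒Far i j (inj₁ i+1<j)))
  symmetric i j (no _) = refl

∑-Des-pairs : {n : ℕ} (σ : Permutation′ n) (f : ℕ → ℕ → ℕ) →
  sum (map (λ { (i , j) → f i j }) (filter (λ { (i , j) → suc j <? i }) (cartesianProduct (Des σ) (Des σ))))
    ≡ ∑[ i ∈ letters n ] ∑[ j ∈ letters n ] (𝟙 (suc j <? i) * (𝟙Des σ i * (𝟙Des σ j * f i j)))
∑-Des-pairs {n} σ f = begin
  ∑ (filter _ (cartesianProduct (Des σ) (Des σ))) _
    ≡⟨ ∑-filter _ (cartesianProduct (Des σ) (Des σ)) _ ⟩
  ∑ (cartesianProduct (Des σ) (Des σ)) _
    ≡⟨ ∑-cartesianProduct (Des σ) (Des σ) _ ⟩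
  ∑[ i ∈ Des σ ] ∑[ j ∈ Des σ ] (𝟙 (suc j <? i) * f i j)
    ≡⟨ ∑-cong (Des σ) (λ i → ∑-Des σ (λ j → 𝟙 (suc j <? i) * f i j)) ⟩
  ∑[ i ∈ Des σ ] ∑[ j ∈ letters n ] (𝟙Des σ j * (𝟙 (suc j <? i) * f i j))
    ≡⟨ ∑-Des σ _ ⟩
  ∑[ i ∈ letters n ] (𝟙Des σ i * ∑[ j ∈ letters n ] (𝟙Des σ j * (𝟙 (suc j <? i) * f i j)))
    ≡⟨ ∑∑-pull-weights (letters n) (letters n) (𝟙Des σ) (𝟙Des σ) (λ i j → 𝟙 (suc j <? i)) f ⟩
  ∑[ i ∈ letters n ] ∑[ j ∈ letters n ] (𝟙 (suc j <? i) * (𝟙Des σ i * (𝟙Des σ j * f i j))) ∎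
  where open ≡-Reasoning

corollary4p11 : (n : ℕ) (σ : Permutation′ n) →
    totalComm σ
      ≡ sum (map (λ i → totalComm (σ · s i)) (Des σ))
        + 2 * sum (map (λ { (i , j) → length (𝓡 (σ · s j · s i)) })
                       (filter (λ { (i , j) → suc j <? i }) (cartesianProduct (Des σ) (Des σ))))
corollary4p11 n σ = begin
  totalComm σ
    ≡⟨ totalComm-∷ʳ σ ⟩
  ∑[ i ∈ letters n ] (𝟙Des σ i * (T i + ∑[ j ∈ letters n ] (𝟙Des σ j * (𝟙 (far? j i) * K i j))))
    ≡⟨ trans (∑-cong (letters n) (λ i → *-distribˡ-+ (𝟙Des σ i) _ _)) (∑-distrib-+ (letters n) _ _) ⟩
  ∑[ i ∈ letters n ] (𝟙Des σ i * T i) + ∑[ i ∈ letters n ] (𝟙Des σ i * ∑[ j ∈ letters n ] (𝟙Des σ j * (𝟙 (far? j i) * K i j)))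
    ≡⟨ cong₂ _+_ (sym (∑-Des σ T)) (∑∑-pull-weights (letters n) (letters n) (𝟙Des σ) (𝟙Des σ) (λ i j → 𝟙 (far? j i)) K) ⟩
  ∑ (Des σ) T + ∑[ i ∈ letters n ] ∑[ j ∈ letters n ] (𝟙 (far? j i) * W i j)
    ≡⟨ cong (∑ (Des σ) T +_) (∑∑-far≡2*∑∑-below (letters n) W W-sym) ⟩
  ∑ (Des σ) T + 2 * ∑[ i ∈ letters n ] ∑[ j ∈ letters n ] (𝟙 (suc j <? i) * W i j)
    ≡⟨ cong (λ x → ∑ (Des σ) T + 2 * x) (∑-Des-pairs σ K) ⟨
  ∑ (Des σ) T + 2 * sum (map (λ { (i , j) → K i j }) (filter (λ { (i , j) → suc j <? i }) (cartesianProduct (Des σ) (Des σ)))) ∎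
  where
  open ≡-Reasoning
  T : ℕ → ℕ
  T i = totalComm (σ · s i)
  K : ℕ → ℕ → ℕ
  K i j = length (𝓡 (σ · s j · s i))
  W : ℕ → ℕ → ℕ
  W i j = 𝟙Des σ i * (𝟙Des σ j * K i j)
  W-sym : ∀ i j → Far i j → W i j ≡ W j i
  W-sym i j far = trans (x*yz≡y*xz (𝟙Des σ i) (𝟙Des σ j) (K i j)) (cong (λ k → 𝟙Des σ j * (𝟙Des σ i * k))
    (length-𝓡-cong {σ = σ · s j · s i} {σ · s i · s j} (λ x → cong (σ ⟨$⟩ʳ_) (s-comm j i (Far-sym i j far) x))))
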